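{- For every $n\ge1$, $$\sum_{F\in F(n)}\prod_{h\in\mathcal{H}(F)}\frac{1}{h^2}=\frac{(n+1)!}{2^n}.$$
   Context: $F(n)$ is the set of labeled forests on $\{1,\dots,n\}$, i.e. sets of rooted labeled trees (children unordered) whose vertex sets partition $\{1,\dots,n\}$. For a vertex $u$ of $F$, the hook length $h_u$ is the number of descendants of $u$ (counting $u$ itself), and $\mathcal{H}(F)$ is the multiset of hook lengths of all vertices; the product is over all vertices. -}

module Defs where

open import Data.Nat using (ℕ; zero; suc; _*_; _^_; NonZero; _!)
open import Data.Nat.Properties using (m^n≢0)
open import Data.Integer using (+_)
open import Data.Rational using (ℚ; _/_; 0ℚ; 1ℚ; _+_) renaming (_*_ to _*ℚ_)
open import Data.Fin using (Fin; _≟_)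
open import Data.Fin.Base using () renaming (zero to fzero)
open import Data.Maybe using (Maybe; just; nothing; is-nothing)
open import Data.Maybe.Base using (_>>=_)
open import Data.Bool using (Bool; true; false)
open import Data.List.Base using (List; []; _∷_; map; concatMap; filterᵇ; length; foldr; allFin; upTo)
open import Data.Bool.ListAction using (and; or)
open import Data.Vec using (Vec; []; _∷_; lookup)
open import Relation.Nullary.Decidable using (does; ⌊_⌋)
open import Relation.Binary.PropositionalEquality using (_≡_)

-- A labeled rooted forest on the vertex set Fin n is encoded by its parent
-- function: each vertex is sent to its parent (just w) or is a root (nothing),
-- subject to acyclicity.
ParentFn : ℕ → Set
ParentFn n = Vec (Maybe (Fin n)) n

iter : ∀ {n} → ParentFn n → ℕ → Fin n → Maybe (Fin n)
iter p zero    v = just v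
iter p (suc k) v = iter p k v >>= λ w → lookup p w

isForest : ∀ {n} → ParentFn n → Bool
isForest {n} p = and (map (λ v → is-nothing (iter p n v)) (allFin n))

allVecs : (m n : ℕ) → List (Vec (Maybe (Fin n)) m)
allVecs zero    n = [] ∷ []
allVecs (suc m) n =
  concatMap (λ x → map (x ∷_) (allVecs m n)) (nothing ∷ map just (allFin n))

forests : (n : ℕ) → List (ParentFn n)
forests n = filterᵇ isForest (allVecs n n)

isDesc : ∀ {n} → ParentFn n → Fin n → Fin n → Bool
isDesc {n} p u v = or (map (λ k → eqM (iter p k v)) (upTo (suc n)))
  where
  eqM : Maybe (Fin n) → Bool
  eqM nothing  = false
  eqM (just w) = does (w ≟ u)

hook : ∀ {n} → ParentFn n → Fin n → ℕ
hook {n} p u = length (filterᵇ (isDesc p u) (allFin n))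

-- 1 / m² as a rational (m = 0 never occurs for hook lengths; value 0 there)
invSq : ℕ → ℚ
invSq zero    = 0ℚ
invSq (suc k) = + 1 / (suc k * suc k)

sumℚ : List ℚ → ℚ
sumℚ = foldr _+_ 0ℚ

prodℚ : List ℚ → ℚ
prodℚ = foldr _*ℚ_ 1ℚ

weight : ∀ {n} → ParentFn n → ℚ
weight {n} p = prodℚ (map (λ u → invSq (hook p u)) (allFin n))

rhs : ℕ → ℚ
rhs n = (+ (suc n !)) / (2 ^ n)
  where instance _ = m^n≢0 2 n

-- Generalise from {1,…,n} to forests on an arbitrary vertex subset S, and let G(S) be the
-- weighted sum over them. Fix m ∈ S and cut a forest at the tree containing m: this is a
-- bijection onto the data (A, r, f₁, f₂) with m ∈ A ⊆ S, r ∈ A, f₁ a forest on A ∖ r and f₂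
-- a forest on S ∖ A. Only the hook of the root r changes, and it becomes |A|, so
--   G(S) = ∑_{m ∈ A ⊆ S} |A| · |A|⁻² · G(A ∖ r) · G(S ∖ A).
-- By strong induction on |S| the value depends only on s = |S| and is (s + 1)!/2^s: with
-- t = s − 1 and |A| = k + 1 the recurrence reduces to ∑ₖ (t choose k) k! (t − k + 1)! = (t + 2)!/2.
module Submission where

open import Defs
open import Data.Nat using (ℕ; _≤_)
open import Data.Bool using (true; false)
open import Data.Bool.Properties using (⇔→≡)
open import Data.List using (map)
open import Data.Maybe using (just; nothing)
open import Function.Bundles using (mk⇔)
open import Relation.Binary.PropositionalEquality using (_≡_; _≢_; cong; module ≡-Reasoning)

true≢false : true ≢ false
true≢false ()

just≢nothing : ∀ {A : Set} {x : A} → just x ≢ nothing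
just≢nothing ()

module Sums where

  open import Data.Nat as ℕ using (ℕ; zero; suc)
  import Data.Nat.Properties as NP
  import Data.Bool.Properties as BP
  open import Data.Rational using (ℚ; 0ℚ; 1ℚ; _+_; _*_)
  open import Data.Rational.Properties
  open import Data.Bool using (Bool; true; false; _∧_; _∨_; not; if_then_else_)
  open import Data.List.Base using (List; []; _∷_; map; concatMap; concat; tabulate; allFin; _++_; filterᵇ; length)
  open import Data.Fin as F using (Fin)
  open import Data.Maybe using (Maybe; just; nothing)
  open import Data.Product using (Σ; _×_; _,_; proj₁; proj₂)
  open import Data.Vec using (Vec; []; _∷_)
  open import Data.Empty using (⊥-elim)
  open import Relation.Nullary.Decidable using (does; dec-true; dec-false)
  open import Relation.Binary.PropositionalEquality hiding ([_])
  open import Function using (_∘_)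
  open import Data.Rational.Solver
  open +-*-Solver

  private
    variable
      A B : Set

  ∑ : List A → (A → ℚ) → ℚ
  ∑ xs f = sumℚ (map f xs)

  [_] : Bool → ℚ
  [ true ] = 1ℚ
  [ false ] = 0ℚ

  ∑-cong : ∀ (xs : List A) {f g : A → ℚ} → (∀ x → f x ≡ g x) → ∑ xs f ≡ ∑ xs g
  ∑-cong [] eq = refl
  ∑-cong (x ∷ xs) eq = cong₂ _+_ (eq x) (∑-cong xs eq)

  ∑-++ : ∀ (xs ys : List A) (f : A → ℚ) → ∑ (xs ++ ys) f ≡ ∑ xs f + ∑ ys f
  ∑-++ [] ys f = sym (+-identityˡ _)
  ∑-++ (x ∷ xs) ys f = trans (cong (f x +_) (∑-++ xs ys f)) (sym (+-assoc (f x) _ _))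

  ∑-map : ∀ (xs : List A) (g : A → B) (f : B → ℚ) → ∑ (map g xs) f ≡ ∑ xs (f ∘ g)
  ∑-map [] g f = refl
  ∑-map (x ∷ xs) g f = cong (f (g x) +_) (∑-map xs g f)

  ∑-concatMap : ∀ (xs : List A) (g : A → List B) (f : B → ℚ) →
    ∑ (concatMap g xs) f ≡ ∑ xs (λ x → ∑ (g x) f)
  ∑-concatMap [] g f = refl
  ∑-concatMap (x ∷ xs) g f =
    trans (∑-++ (g x) (concat (map g xs)) f) (cong (∑ (g x) f +_) (∑-concatMap xs g f))

  ∑-+ : ∀ (xs : List A) (f g : A → ℚ) → ∑ xs (λ x → f x + g x) ≡ ∑ xs f + ∑ xs g
  ∑-+ [] f g = refl
  ∑-+ (x ∷ xs) f g = trans (cong (f x + g x +_) (∑-+ xs f g))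
    (solve 4 (λ a b c d → (a :+ b) :+ (c :+ d) := (a :+ c) :+ (b :+ d)) refl (f x) (g x) (∑ xs f) (∑ xs g))

  ∑-*ˡ : ∀ (xs : List A) (c : ℚ) (f : A → ℚ) → ∑ xs (λ x → c * f x) ≡ c * ∑ xs f
  ∑-*ˡ [] c f = sym (*-zeroʳ c)
  ∑-*ˡ (x ∷ xs) c f = trans (cong (c * f x +_) (∑-*ˡ xs c f)) (sym (*-distribˡ-+ c (f x) _))

  ∑-*ʳ : ∀ (xs : List A) (c : ℚ) (f : A → ℚ) → ∑ xs (λ x → f x * c) ≡ ∑ xs f * c
  ∑-*ʳ xs c f = trans (∑-cong xs (λ x → *-comm (f x) c))
    (trans (∑-*ˡ xs c f) (*-comm c _))

  ∑-filterᵇ : ∀ (P : A → Bool) (f : A → ℚ) xs → sumℚ (map f (filterᵇ P xs)) ≡ ∑ xs (λ x → [ P x ] * f x)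
  ∑-filterᵇ P f [] = refl
  ∑-filterᵇ P f (x ∷ xs) with P x
  ... | true = cong₂ _+_ (sym (*-identityˡ (f x))) (∑-filterᵇ P f xs)
  ... | false = trans (∑-filterᵇ P f xs) (sym (trans (cong (_+ _) (*-zeroˡ (f x))) (+-identityˡ _)))

  ∑-0 : ∀ (xs : List A) → ∑ xs (λ _ → 0ℚ) ≡ 0ℚ
  ∑-0 [] = refl
  ∑-0 (x ∷ xs) = trans (+-identityˡ _) (∑-0 xs)

  ∑-swap : ∀ (xs : List A) (ys : List B) (F : A → B → ℚ) →
    ∑ xs (λ x → ∑ ys (λ y → F x y)) ≡ ∑ ys (λ y → ∑ xs (λ x → F x y))
  ∑-swap [] ys F = sym (∑-0 ys)
  ∑-swap (x ∷ xs) ys F = trans (cong (∑ ys (F x) +_) (∑-swap xs ys F))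
    (sym (∑-+ ys (F x) (λ y → ∑ xs (λ x' → F x' y))))

  [∧] : ∀ a b → [ a ∧ b ] ≡ [ a ] * [ b ]
  [∧] true b = sym (*-identityˡ [ b ])
  [∧] false b = sym (*-zeroˡ [ b ])

  [∧]-* : ∀ a b x → [ a ] * ([ b ] * x) ≡ [ a ∧ b ] * x
  [∧]-* a b x = trans (sym (*-assoc [ a ] [ b ] x)) (cong (_* x) (sym ([∧] a b)))

  []*-cong : ∀ b {x y} → (b ≡ true → x ≡ y) → [ b ] * x ≡ [ b ] * y
  []*-cong true f = cong ([ true ] *_) (f refl)
  []*-cong false {x} {y} f = trans (*-zeroˡ x) (sym (*-zeroˡ y))

  -- ∑-δ forces elements to list every value exactly once.
  record Enumeration (A : Set) : Set where
    field
      elements : List A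
      equal : A → A → Bool
      equal-sound : ∀ {x y} → equal x y ≡ true → x ≡ y
      equal-refl : ∀ x → equal x x ≡ true
      ∑-δ : ∀ a (h : A → ℚ) → ∑ elements (λ x → [ equal x a ] * h x) ≡ h a
  open Enumeration public

  eqᵇ : ∀ {n} → Fin n → Fin n → Bool
  eqᵇ x y = does (x F.≟ y)

  eqᵇ-sound : ∀ {n} {x y : Fin n} → eqᵇ x y ≡ true → x ≡ y
  eqᵇ-sound {x = F.zero} {F.zero} e = refl
  eqᵇ-sound {x = F.zero} {F.suc y} ()
  eqᵇ-sound {x = F.suc x} {F.zero} ()
  eqᵇ-sound {x = F.suc x} {F.suc y} e = cong F.suc (eqᵇ-sound e)

  eqᵇ-refl : ∀ {n} (x : Fin n) → eqᵇ x x ≡ true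
  eqᵇ-refl x = dec-true (x F.≟ x) refl

  eqᵇ-≢ : ∀ {n} {x y : Fin n} → x ≢ y → eqᵇ x y ≡ false
  eqᵇ-≢ {x = x} {y} = dec-false (x F.≟ y)

  eqᵇ-false⇒≢ : ∀ {n} {x y : Fin n} → eqᵇ x y ≡ false → x ≢ y
  eqᵇ-false⇒≢ {x = x} e refl = true≢false (trans (sym (eqᵇ-refl x)) e)

  ∑-tabulate : ∀ {B : Set} m (f : Fin m → B) (h : B → ℚ) → ∑ (tabulate f) h ≡ ∑ (allFin m) (h ∘ f)
  ∑-tabulate zero f h = refl
  ∑-tabulate (suc m) f h = cong (h (f F.zero) +_) (trans (∑-tabulate m (f ∘ F.suc) h) (sym (∑-tabulate m F.suc (h ∘ f))))

  ∑-allFin-suc : ∀ n (h : Fin (suc n) → ℚ) → ∑ (allFin (suc n)) h ≡ h F.zero + ∑ (allFin n) (h ∘ F.suc)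
  ∑-allFin-suc n h = cong (h F.zero +_) (∑-tabulate n F.suc h)

  ∑-δ-Fin : ∀ n (a : Fin n) (h : Fin n → ℚ) → ∑ (allFin n) (λ x → [ eqᵇ x a ] * h x) ≡ h a
  ∑-δ-Fin (suc n) F.zero h = begin
    _ ≡⟨ ∑-allFin-suc n (λ x → [ eqᵇ x F.zero ] * h x) ⟩
    [ true ] * h F.zero + ∑ (allFin n) (λ x → [ false ] * h (F.suc x))
      ≡⟨ cong₂ _+_ (*-identityˡ (h F.zero)) (trans (∑-cong (allFin n) (λ x → *-zeroˡ (h (F.suc x)))) (∑-0 (allFin n))) ⟩
    h F.zero + 0ℚ ≡⟨ +-identityʳ _ ⟩
    h F.zero ∎ where open ≡-Reasoning
  ∑-δ-Fin (suc n) (F.suc a) h = begin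
    _ ≡⟨ ∑-allFin-suc n (λ x → [ eqᵇ x (F.suc a) ] * h x) ⟩
    [ false ] * h F.zero + ∑ (allFin n) (λ x → [ eqᵇ x a ] * h (F.suc x))
      ≡⟨ cong₂ _+_ (*-zeroˡ (h F.zero)) (∑-δ-Fin n a (h ∘ F.suc)) ⟩
    0ℚ + h (F.suc a) ≡⟨ +-identityˡ _ ⟩
    h (F.suc a) ∎ where open ≡-Reasoning

  enumFin : ∀ n → Enumeration (Fin n)
  enumFin n = record { elements = allFin n ; equal = eqᵇ ; equal-sound = eqᵇ-sound ; equal-refl = eqᵇ-refl ; ∑-δ = ∑-δ-Fin n }

  eqᵇ-Maybe : ∀ {n} → Maybe (Fin n) → Maybe (Fin n) → Bool
  eqᵇ-Maybe nothing nothing = true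
  eqᵇ-Maybe nothing (just _) = false
  eqᵇ-Maybe (just _) nothing = false
  eqᵇ-Maybe (just x) (just y) = eqᵇ x y

  enumMaybeFin : ∀ n → Enumeration (Maybe (Fin n))
  enumMaybeFin n = record { elements = nothing ∷ map just (allFin n) ; equal = eqᵇ-Maybe ; equal-sound = snd ; equal-refl = rfl ; ∑-δ = dl }
    where
    snd : ∀ {x y : Maybe (Fin n)} → eqᵇ-Maybe x y ≡ true → x ≡ y
    snd {nothing} {nothing} e = refl
    snd {just x} {just y} e = cong just (eqᵇ-sound e)
    rfl : ∀ x → eqᵇ-Maybe x x ≡ true
    rfl nothing = refl
    rfl (just x) = eqᵇ-refl x
    dl : ∀ a (h : Maybe (Fin n) → ℚ) → ∑ (nothing ∷ map just (allFin n)) (λ x → [ eqᵇ-Maybe x a ] * h x) ≡ h a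
    dl nothing h = begin
      _ ≡⟨ cong ([ true ] * h nothing +_) (∑-map (allFin n) just (λ x → [ eqᵇ-Maybe x nothing ] * h x)) ⟩
      [ true ] * h nothing + ∑ (allFin n) (λ x → [ false ] * h (just x))
        ≡⟨ cong₂ _+_ (*-identityˡ (h nothing)) (trans (∑-cong (allFin n) (λ x → *-zeroˡ (h (just x)))) (∑-0 (allFin n))) ⟩
      h nothing + 0ℚ ≡⟨ +-identityʳ _ ⟩
      h nothing ∎ where open ≡-Reasoning
    dl (just a) h = begin
      _ ≡⟨ cong ([ false ] * h nothing +_) (∑-map (allFin n) just (λ x → [ eqᵇ-Maybe x (just a) ] * h x)) ⟩
      [ false ] * h nothing + ∑ (allFin n) (λ x → [ eqᵇ x a ] * h (just x))
        ≡⟨ cong₂ _+_ (*-zeroˡ (h nothing)) (∑-δ-Fin n a (h ∘ just)) ⟩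
      0ℚ + h (just a) ≡⟨ +-identityˡ _ ⟩
      h (just a) ∎ where open ≡-Reasoning

  eqᵇ-Bool : Bool → Bool → Bool
  eqᵇ-Bool true true = true
  eqᵇ-Bool false false = true
  eqᵇ-Bool _ _ = false

  enumBool : Enumeration Bool
  enumBool = record { elements = false ∷ true ∷ [] ; equal = eqᵇ-Bool ; equal-sound = snd ; equal-refl = rfl ; ∑-δ = dl }
    where
    snd : ∀ {x y} → eqᵇ-Bool x y ≡ true → x ≡ y
    snd {true} {true} e = refl
    snd {false} {false} e = refl
    rfl : ∀ x → eqᵇ-Bool x x ≡ true
    rfl true = refl
    rfl false = refl
    dl : ∀ a (h : Bool → ℚ) → ∑ (false ∷ true ∷ []) (λ x → [ eqᵇ-Bool x a ] * h x) ≡ h a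
    dl true h = solve 2 (λ x y → con 0ℚ :* x :+ (con 1ℚ :* y :+ con 0ℚ) := y) refl (h false) (h true)
    dl false h = solve 2 (λ x y → con 1ℚ :* x :+ (con 0ℚ :* y :+ con 0ℚ) := x) refl (h false) (h true)

  pairs : List A → List B → List (A × B)
  pairs xs ys = concatMap (λ x → map (x ,_) ys) xs

  ∑-pairs : ∀ (xs : List A) (ys : List B) (f : A × B → ℚ) →
    ∑ (pairs xs ys) f ≡ ∑ xs (λ x → ∑ ys (λ y → f (x , y)))
  ∑-pairs xs ys f = trans (∑-concatMap xs (λ x → map (x ,_) ys) f)
    (∑-cong xs (λ x → ∑-map ys (x ,_) f))

  ∧-≡true : ∀ {a b} → a ∧ b ≡ true → a ≡ true × b ≡ true
  ∧-≡true {true} {true} e = refl , refl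

  ∑-∑-[∧] : ∀ (xs : List A) (ys : List B) (a : A → Bool) (b : B → Bool) (h : A → B → ℚ) →
    ∑ xs (λ x → ∑ ys (λ y → [ a x ∧ b y ] * h x y)) ≡ ∑ xs (λ x → [ a x ] * ∑ ys (λ y → [ b y ] * h x y))
  ∑-∑-[∧] xs ys a b h =
    ∑-cong xs (λ x → trans (∑-cong ys (λ y → sym ([∧]-* (a x) (b y) (h x y)))) (∑-*ˡ ys [ a x ] _))

  enum× : Enumeration A → Enumeration B → Enumeration (A × B)
  enum× {A} {B} EA EB = record { elements = pairs (elements EA) (elements EB) ; equal = eq ; equal-sound = snd ; equal-refl = rfl ; ∑-δ = dl }
    where
    eq : _ → _ → Bool
    eq (x , y) (a , b) = equal EA x a ∧ equal EB y b
    snd : ∀ {x y} → eq x y ≡ true → x ≡ y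
    snd {x , y} {a , b} e = cong₂ _,_ (equal-sound EA (proj₁ (∧-≡true e))) (equal-sound EB (proj₂ (∧-≡true e)))
    rfl : ∀ x → eq x x ≡ true
    rfl (x , y) = cong₂ _∧_ (equal-refl EA x) (equal-refl EB y)
    dl : ∀ (a : A × B) (h : A × B → ℚ) → ∑ (pairs (elements EA) (elements EB)) (λ x → [ eq x a ] * h x) ≡ h a
    dl (a , b) h = begin
      _ ≡⟨ ∑-pairs (elements EA) (elements EB) _ ⟩
      ∑ (elements EA) (λ x → ∑ (elements EB) (λ y → [ equal EA x a ∧ equal EB y b ] * h (x , y)))
        ≡⟨ ∑-∑-[∧] (elements EA) (elements EB) (λ x → equal EA x a) (λ y → equal EB y b) (λ x y → h (x , y)) ⟩
      ∑ (elements EA) (λ x → [ equal EA x a ] * ∑ (elements EB) (λ y → [ equal EB y b ] * h (x , y)))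
        ≡⟨ ∑-δ EA a _ ⟩
      ∑ (elements EB) (λ y → [ equal EB y b ] * h (a , y)) ≡⟨ ∑-δ EB b _ ⟩
      h (a , b) ∎ where open ≡-Reasoning

  vectors : Enumeration A → ∀ m → List (Vec A m)
  vectors E zero = [] ∷ []
  vectors E (suc m) = concatMap (λ x → map (x ∷_) (vectors E m)) (elements E)

  ∑-vectors-suc : ∀ (E : Enumeration A) m (f : Vec A (suc m) → ℚ) →
    ∑ (vectors E (suc m)) f ≡ ∑ (elements E) (λ x → ∑ (vectors E m) (λ v → f (x ∷ v)))
  ∑-vectors-suc E m f = trans (∑-concatMap (elements E) _ f) (∑-cong (elements E) (λ x → ∑-map (vectors E m) (x ∷_) f))

  enumVec : Enumeration A → ∀ m → Enumeration (Vec A m)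
  enumVec {A} E m = record { elements = vectors E m ; equal = eq ; equal-sound = snd ; equal-refl = rfl ; ∑-δ = dl m }
    where
    eq : ∀ {k} → Vec A k → Vec A k → Bool
    eq [] [] = true
    eq (x ∷ xs) (y ∷ ys) = equal E x y ∧ eq xs ys
    snd : ∀ {k} {x y : Vec A k} → eq x y ≡ true → x ≡ y
    snd {x = []} {[]} e = refl
    snd {x = x ∷ xs} {y ∷ ys} e = cong₂ _∷_ (equal-sound E (proj₁ (∧-≡true e))) (snd (proj₂ (∧-≡true e)))
    rfl : ∀ {k} (x : Vec A k) → eq x x ≡ true
    rfl [] = refl
    rfl (x ∷ xs) = cong₂ _∧_ (equal-refl E x) (rfl xs)
    dl : ∀ k (a : Vec A k) (h : Vec A k → ℚ) → ∑ (vectors E k) (λ x → [ eq x a ] * h x) ≡ h a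
    dl zero [] h = trans (+-identityʳ ([ true ] * h [])) (*-identityˡ (h []))
    dl (suc k) (a ∷ as) h = begin
      _ ≡⟨ ∑-vectors-suc E k _ ⟩
      ∑ (elements E) (λ x → ∑ (vectors E k) (λ v → [ equal E x a ∧ eq v as ] * h (x ∷ v)))
        ≡⟨ ∑-∑-[∧] (elements E) (vectors E k) (λ x → equal E x a) (λ v → eq v as) (λ x v → h (x ∷ v)) ⟩
      ∑ (elements E) (λ x → [ equal E x a ] * ∑ (vectors E k) (λ v → [ eq v as ] * h (x ∷ v)))
        ≡⟨ ∑-δ E a _ ⟩
      ∑ (vectors E k) (λ v → [ eq v as ] * h (a ∷ v)) ≡⟨ dl k as _ ⟩
      h (a ∷ as) ∎ where open ≡-Reasoning

  allVecs≡vectors : ∀ m n → allVecs m n ≡ vectors (enumMaybeFin n) m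
  allVecs≡vectors zero n = refl
  allVecs≡vectors (suc m) n = cong (λ L → concatMap (λ x → map (x ∷_) L) (nothing ∷ map just (allFin n))) (allVecs≡vectors m n)

  module _ {X Y : Set} (EX : Enumeration X) (EY : Enumeration Y)
           (P : X → Bool) (Q : Y → Bool) (φ : Y → X)
           (φ-maps : ∀ y → Q y ≡ true → P (φ y) ≡ true)
           (φ-injective : ∀ y y' → Q y ≡ true → Q y' ≡ true → φ y ≡ φ y' → y ≡ y')
           (φ-surjective : ∀ x → P x ≡ true → Σ Y λ y → Q y ≡ true × φ y ≡ x) where

    private
      LX : List X
      LX = elements EX
      LY : List Y
      LY = elements EY

    ∑-fibre : ∀ x → ∑ LY (λ y → [ Q y ∧ equal EX x (φ y) ]) ≡ [ P x ]
    ∑-fibre x with P x in px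
    ... | true = trans (∑-cong LY (λ y → trans (cong [_] (inFibre y)) (sym (*-identityʳ _))))
                       (∑-δ EY y₀ (λ _ → 1ℚ))
      where
      y₀ : Y
      y₀ = proj₁ (φ-surjective x px)
      Qy₀ : Q y₀ ≡ true
      Qy₀ = proj₁ (proj₂ (φ-surjective x px))
      φy₀ : φ y₀ ≡ x
      φy₀ = proj₂ (proj₂ (φ-surjective x px))
      inFibre : ∀ y → Q y ∧ equal EX x (φ y) ≡ equal EY y y₀
      inFibre y with equal EY y y₀ in y=y₀
      ... | true rewrite equal-sound EY y=y₀ | Qy₀ | φy₀ = equal-refl EX x
      ... | false with Q y ∧ equal EX x (φ y) in c
      ...   | false = refl
      ...   | true = ⊥-elim (true≢false (trans (sym (equal-refl EY y₀))
                         (subst (λ z → equal EY z y₀ ≡ false) y≡y₀ y=y₀)))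
        where
        y≡y₀ : y ≡ y₀
        y≡y₀ = φ-injective y y₀ (proj₁ (∧-≡true c))
                 Qy₀ (trans (sym (equal-sound EX (proj₂ (∧-≡true c)))) (sym φy₀))
    ... | false = trans (∑-cong LY (λ y → cong [_] (notInFibre y))) (∑-0 LY)
      where
      notInFibre : ∀ y → Q y ∧ equal EX x (φ y) ≡ false
      notInFibre y with Q y ∧ equal EX x (φ y) in c
      ... | false = refl
      ... | true = ⊥-elim (true≢false (trans (sym (φ-maps y (proj₁ (∧-≡true c))))
                     (trans (cong P (sym (equal-sound EX (proj₂ (∧-≡true c))))) px)))

    ∑-reindex : ∀ (g : X → ℚ) → ∑ LX (λ x → [ P x ] * g x) ≡ ∑ LY (λ y → [ Q y ] * g (φ y))
    ∑-reindex g = sym (begin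
      ∑ LY (λ y → [ Q y ] * g (φ y))
        ≡⟨ ∑-cong LY (λ y → cong ([ Q y ] *_) (sym (∑-δ EX (φ y) g))) ⟩
      ∑ LY (λ y → [ Q y ] * ∑ LX (λ x → [ equal EX x (φ y) ] * g x))
        ≡⟨ ∑-cong LY (λ y → sym (∑-*ˡ LX [ Q y ] (λ x → [ equal EX x (φ y) ] * g x))) ⟩
      ∑ LY (λ y → ∑ LX (λ x → [ Q y ] * ([ equal EX x (φ y) ] * g x)))
        ≡⟨ ∑-swap LY LX (λ y x → [ Q y ] * ([ equal EX x (φ y) ] * g x)) ⟩
      ∑ LX (λ x → ∑ LY (λ y → [ Q y ] * ([ equal EX x (φ y) ] * g x)))
        ≡⟨ ∑-cong LX (λ x → trans (∑-cong LY (λ y → [∧]-* (Q y) (equal EX x (φ y)) (g x)))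
                                  (∑-*ʳ LY (g x) (λ y → [ Q y ∧ equal EX x (φ y) ]))) ⟩
      ∑ LX (λ x → ∑ LY (λ y → [ Q y ∧ equal EX x (φ y) ]) * g x)
        ≡⟨ ∑-cong LX (λ x → cong (_* g x) (∑-fibre x)) ⟩
      ∑ LX (λ x → [ P x ] * g x) ∎)
      where open ≡-Reasoning

  -- binomialSum t ψ = ∑ₖ (t choose k) · ψ k, via Pascal's rule.
  binomialSum : ℕ → (ℕ → ℚ) → ℚ
  binomialSum zero ψ = ψ zero
  binomialSum (suc t) ψ = binomialSum t ψ + binomialSum t (λ k → ψ (suc k))

  binomialSum-cong : ∀ t {ψ ψ' : ℕ → ℚ} → (∀ k → k ℕ.≤ t → ψ k ≡ ψ' k) → binomialSum t ψ ≡ binomialSum t ψ'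
  binomialSum-cong zero eq = eq zero ℕ.z≤n
  binomialSum-cong (suc t) eq = cong₂ _+_ (binomialSum-cong t (λ k k≤ → eq k (NP.m≤n⇒m≤1+n k≤)))
                                  (binomialSum-cong t (λ k k≤ → eq (suc k) (ℕ.s≤s k≤)))

  isSubset : ∀ {n} → Vec Bool n → Vec Bool n → Bool
  isSubset [] [] = true
  isSubset (a ∷ A) (s ∷ S) = (not a ∨ s) ∧ isSubset A S

  countTrue : ∀ {n} → Vec Bool n → ℕ
  countTrue [] = zero
  countTrue (true ∷ A) = suc (countTrue A)
  countTrue (false ∷ A) = countTrue A

  countTrue-mono : ∀ {n} (A S : Vec Bool n) → isSubset A S ≡ true → countTrue A ℕ.≤ countTrue S
  countTrue-mono [] [] e = ℕ.z≤n
  countTrue-mono (true ∷ A) (true ∷ S) e = ℕ.s≤s (countTrue-mono A S e)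
  countTrue-mono (false ∷ A) (true ∷ S) e = NP.m≤n⇒m≤1+n (countTrue-mono A S e)
  countTrue-mono (false ∷ A) (false ∷ S) e = countTrue-mono A S e

  ∑-Bool : ∀ (F : Bool → ℚ) → ∑ (false ∷ true ∷ []) F ≡ F false + F true
  ∑-Bool F = cong (F false +_) (+-identityʳ (F true))

  ∑-vectors-Bool-suc : ∀ n (F : Vec Bool (suc n) → ℚ) →
    ∑ (vectors enumBool (suc n)) F ≡ ∑ (vectors enumBool n) (λ v → F (false ∷ v)) + ∑ (vectors enumBool n) (λ v → F (true ∷ v))
  ∑-vectors-Bool-suc n F = trans (∑-vectors-suc enumBool n F) (∑-Bool (λ x → ∑ (vectors enumBool n) (λ v → F (x ∷ v))))

  ∑-between-binomialSum : ∀ n (B S : Vec Bool n) (Φ : ℕ → ℚ) → isSubset B S ≡ true →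
    ∑ (vectors enumBool n) (λ A → [ isSubset B A ∧ isSubset A S ] * Φ (countTrue A))
      ≡ binomialSum (countTrue S ℕ.∸ countTrue B) (λ k → Φ (countTrue B ℕ.+ k))
  ∑-between-binomialSum zero [] [] Φ e = trans (+-identityʳ _) (*-identityˡ (Φ zero))
  ∑-between-binomialSum (suc n) (false ∷ B) (false ∷ S) Φ e = begin
    _ ≡⟨ ∑-vectors-Bool-suc n _ ⟩
    ∑ (vectors enumBool n) (λ A → [ isSubset B A ∧ isSubset A S ] * Φ (countTrue A)) +
    ∑ (vectors enumBool n) (λ A → [ isSubset B A ∧ false ] * Φ (suc (countTrue A)))
      ≡⟨ cong₂ _+_ (∑-between-binomialSum n B S Φ e)
          (trans (∑-cong (vectors enumBool n) (λ A → trans (cong (λ z → [ z ] * Φ (suc (countTrue A))) (BP.∧-zeroʳ (isSubset B A)))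
                                                         (*-zeroˡ (Φ (suc (countTrue A))))))
                 (∑-0 (vectors enumBool n))) ⟩
    binomialSum (countTrue S ℕ.∸ countTrue B) (λ k → Φ (countTrue B ℕ.+ k)) + 0ℚ ≡⟨ +-identityʳ _ ⟩
    _ ∎ where open ≡-Reasoning
  ∑-between-binomialSum (suc n) (true ∷ B) (true ∷ S) Φ e = begin
    _ ≡⟨ ∑-vectors-Bool-suc n _ ⟩
    ∑ (vectors enumBool n) (λ A → [ false ] * Φ (countTrue A)) +
    ∑ (vectors enumBool n) (λ A → [ isSubset B A ∧ isSubset A S ] * Φ (suc (countTrue A)))
      ≡⟨ cong₂ _+_ (trans (∑-cong (vectors enumBool n) (λ A → *-zeroˡ (Φ (countTrue A)))) (∑-0 (vectors enumBool n)))
                   (∑-between-binomialSum n B S (λ k → Φ (suc k)) e) ⟩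
    0ℚ + binomialSum (countTrue S ℕ.∸ countTrue B) (λ k → Φ (suc (countTrue B ℕ.+ k))) ≡⟨ +-identityˡ _ ⟩
    _ ∎ where open ≡-Reasoning
  ∑-between-binomialSum (suc n) (false ∷ B) (true ∷ S) Φ e = begin
    _ ≡⟨ ∑-vectors-Bool-suc n _ ⟩
    ∑ (vectors enumBool n) (λ A → [ isSubset B A ∧ isSubset A S ] * Φ (countTrue A)) +
    ∑ (vectors enumBool n) (λ A → [ isSubset B A ∧ isSubset A S ] * Φ (suc (countTrue A)))
      ≡⟨ cong₂ _+_ (∑-between-binomialSum n B S Φ e) (∑-between-binomialSum n B S (λ k → Φ (suc k)) e) ⟩
    binomialSum (countTrue S ℕ.∸ countTrue B) (λ k → Φ (countTrue B ℕ.+ k)) +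
    binomialSum (countTrue S ℕ.∸ countTrue B) (λ k → Φ (suc (countTrue B ℕ.+ k)))
      ≡⟨ cong (binomialSum (countTrue S ℕ.∸ countTrue B) (λ k → Φ (countTrue B ℕ.+ k)) +_)
           (binomialSum-cong (countTrue S ℕ.∸ countTrue B) (λ k _ → cong Φ (sym (NP.+-suc (countTrue B) k)))) ⟩
    binomialSum (suc (countTrue S ℕ.∸ countTrue B)) (λ k → Φ (countTrue B ℕ.+ k))
      ≡⟨ cong (λ t → binomialSum t (λ k → Φ (countTrue B ℕ.+ k))) (sym (NP.+-∸-assoc 1 (countTrue-mono B S e))) ⟩
    _ ∎ where open ≡-Reasoning

  ∏ : ∀ {B : Set} → List B → (B → ℚ) → ℚ
  ∏ xs f = prodℚ (map f xs)

  ∏-cong : ∀ {B : Set} (xs : List B) {f g : B → ℚ} → (∀ x → f x ≡ g x) → ∏ xs f ≡ ∏ xs g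
  ∏-cong [] eq = refl
  ∏-cong (x ∷ xs) eq = cong₂ _*_ (eq x) (∏-cong xs eq)

  ∏-* : ∀ {B : Set} (xs : List B) (f g : B → ℚ) → ∏ xs (λ x → f x * g x) ≡ ∏ xs f * ∏ xs g
  ∏-* [] f g = sym (*-identityˡ 1ℚ)
  ∏-* (x ∷ xs) f g = trans (cong (f x * g x *_) (∏-* xs f g))
    (solve 4 (λ a b c d → (a :* b) :* (c :* d) := (a :* c) :* (b :* d)) refl (f x) (g x) (∏ xs f) (∏ xs g))

  ∏-tabulate : ∀ {B : Set} m (f : Fin m → B) (h : B → ℚ) → ∏ (tabulate f) h ≡ ∏ (allFin m) (h ∘ f)
  ∏-tabulate zero f h = refl
  ∏-tabulate (suc m) f h = cong (h (f F.zero) *_) (trans (∏-tabulate m (f ∘ F.suc) h) (sym (∏-tabulate m F.suc (h ∘ f))))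

  ∏-1 : ∀ {B : Set} (xs : List B) → ∏ xs (λ _ → 1ℚ) ≡ 1ℚ
  ∏-1 [] = refl
  ∏-1 (x ∷ xs) = trans (*-identityˡ _) (∏-1 xs)

  ∏-δ : ∀ n (r : Fin n) x → ∏ (allFin n) (λ u → if eqᵇ u r then x else 1ℚ) ≡ x
  ∏-δ (suc n) F.zero x = trans (cong (x *_) (trans (∏-tabulate n F.suc (λ u → if eqᵇ u F.zero then x else 1ℚ)) (∏-1 (allFin n)))) (*-identityʳ x)
  ∏-δ (suc n) (F.suc r) x = trans (*-identityˡ _) (trans (∏-tabulate n F.suc (λ u → if eqᵇ u (F.suc r) then x else 1ℚ)) (∏-δ n r x))

  length-filter-cong : ∀ {A : Set} (f g : A → Bool) (xs : List A) → (∀ x → f x ≡ g x) → length (filterᵇ f xs) ≡ length (filterᵇ g xs)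
  length-filter-cong f g xs eq = cong length (go xs)
    where
    go : ∀ xs → filterᵇ f xs ≡ filterᵇ g xs
    go [] = refl
    go (x ∷ xs) rewrite eq x with g x
    ... | true = cong (x ∷_) (go xs)
    ... | false = go xs

  length-filter-tabulate : ∀ {B : Set} n (f : B → Bool) (g : Fin n → B) → length (filterᵇ f (tabulate g)) ≡ length (filterᵇ (f ∘ g) (allFin n))
  length-filter-tabulate zero f g = refl
  length-filter-tabulate {B} (suc n) f g with f (g F.zero)
  ... | true = cong suc (trans (length-filter-tabulate n f (g ∘ F.suc)) (sym (length-filter-tabulate n (f ∘ g) F.suc)))
  ... | false = trans (length-filter-tabulate n f (g ∘ F.suc)) (sym (length-filter-tabulate n (f ∘ g) F.suc))

  length-filter-all : ∀ {B : Set} (f : B → Bool) xs → (∀ x → f x ≡ true) → length (filterᵇ f xs) ≡ length xs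
  length-filter-all f [] h = refl
  length-filter-all f (x ∷ xs) h rewrite h x = cong suc (length-filter-all f xs h)

  length-filter-none : ∀ {B : Set} (f : B → Bool) xs → (∀ x → f x ≡ false) → length (filterᵇ f xs) ≡ 0
  length-filter-none f [] h = refl
  length-filter-none f (x ∷ xs) h rewrite h x = length-filter-none f xs h

  count-eqᵇ : ∀ n (u : Fin n) → length (filterᵇ (λ v → eqᵇ v u) (allFin n)) ≡ 1
  count-eqᵇ (suc n) F.zero = cong suc (trans (length-filter-tabulate n (λ v → eqᵇ v F.zero) F.suc) (length-filter-none _ (allFin n) (λ x → refl)))
  count-eqᵇ (suc n) (F.suc u) = trans (length-filter-tabulate n (λ v → eqᵇ v (F.suc u)) F.suc) (count-eqᵇ n u)

  length-filter-split : ∀ {B : Set} (f g : B → Bool) xs → (∀ x → g x ≡ true → f x ≡ true) →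
    length (filterᵇ (λ x → f x ∧ not (g x)) xs) ℕ.+ length (filterᵇ g xs) ≡ length (filterᵇ f xs)
  length-filter-split f g [] h = refl
  length-filter-split f g (x ∷ xs) h with f x in fx | g x in gx
  ... | true | true = trans (NP.+-suc _ _) (cong suc (length-filter-split f g xs h))
  ... | true | false = cong suc (length-filter-split f g xs h)
  ... | false | false = length-filter-split f g xs h
  ... | false | true = ⊥-elim (true≢false (trans (sym (h x gx)) fx))

module Ancestry where

  open import Data.Nat as ℕ using (ℕ; zero; suc; _+_; _*_; _∸_; _≤_; _<_; z≤n; s≤s)
  import Data.Nat.Properties as NP
  open import Data.Bool using (Bool; true; false)
  open import Data.List.Base using (map; applyUpTo; allFin)
  open import Data.Bool.ListAction using (or)
  open import Data.Fin using (Fin; toℕ)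
  import Data.Fin.Properties as FP
  open import Data.Maybe using (Maybe; just; nothing; maybe)
  open import Data.Maybe.Base using (_>>=_)
  open import Data.Product using (Σ; _×_; _,_)
  open import Data.Vec using (lookup)
  open import Data.Empty using (⊥-elim)
  open import Relation.Binary.PropositionalEquality
  open import Function using (_∘_; id)
  open import Data.Sum using (inj₁; inj₂)

  private
    variable
      n : ℕ

  >>=-just : ∀ {A : Set} (m : Maybe A) → (m >>= just) ≡ m
  >>=-just nothing = refl
  >>=-just (just x) = refl

  iter-sucˡ : ∀ (p : ParentFn n) k v → iter p (suc k) v ≡ (lookup p v >>= iter p k)
  iter-sucˡ p zero v = sym (>>=-just (lookup p v))
  iter-sucˡ p (suc k) v = trans (cong (_>>= lookup p) (iter-sucˡ p k v)) (lem (lookup p v))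
    where
    lem : ∀ m → ((m >>= iter p k) >>= lookup p) ≡ (m >>= iter p (suc k))
    lem nothing = refl
    lem (just x) = refl

  iter-+ : ∀ (p : ParentFn n) k d v → iter p (k + d) v ≡ (iter p k v >>= iter p d)
  iter-+ p zero d v = refl
  iter-+ p (suc k) d v = trans (iter-sucˡ p (k + d) v)
    (trans (lem (lookup p v)) (cong (_>>= iter p d) (sym (iter-sucˡ p k v))))
    where
    lem : ∀ m → (m >>= iter p (k + d)) ≡ ((m >>= iter p k) >>= iter p d)
    lem nothing = refl
    lem (just x) = iter-+ p k d x

  iter-+-nothing : ∀ (p : ParentFn n) k d v → iter p k v ≡ nothing → iter p (k + d) v ≡ nothing
  iter-+-nothing p k d v e = trans (iter-+ p k d v) (cong (_>>= iter p d) e)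

  iter-+-just : ∀ (p : ParentFn n) k d v u → iter p k v ≡ just u → iter p (k + d) v ≡ iter p d u
  iter-+-just p k d v u e = trans (iter-+ p k d v) (cong (_>>= iter p d) e)

  iter-nothing-≤ : ∀ (p : ParentFn n) v {k m} → k ≤ m → iter p k v ≡ nothing → iter p m v ≡ nothing
  iter-nothing-≤ p v {k} k≤m e =
    subst (λ z → iter p z v ≡ nothing) (NP.m+[n∸m]≡n k≤m) (iter-+-nothing p k (_ ∸ k) v e)

  Acyclic : ParentFn n → Set
  Acyclic {n} p = ∀ v → iter p n v ≡ nothing

  Acyclic-iter-bound : ∀ (p : ParentFn n) → Acyclic p → ∀ k v u → iter p k v ≡ just u → k < n
  Acyclic-iter-bound {n} p ac k v u e with NP.<-≤-connex k n
  ... | inj₁ k<n = k<n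
  ... | inj₂ n≤k = ⊥-elim (just≢nothing (trans (sym e) (iter-nothing-≤ p v n≤k (ac v))))

  open Sums using (eqᵇ-sound; eqᵇ-refl; length-filter-cong)

  or-sound : ∀ (f : ℕ → Bool) (g : ℕ → ℕ) m → or (map f (applyUpTo g m)) ≡ true → Σ ℕ (λ k → k < m × f (g k) ≡ true)
  or-sound f g (suc m) e with f (g 0) in e0
  ... | true = 0 , s≤s z≤n , e0
  ... | false with or-sound f (g ∘ suc) m e
  ... | k , k<m , ek = suc k , s≤s k<m , ek

  or-false : ∀ (f : ℕ → Bool) (g : ℕ → ℕ) m → or (map f (applyUpTo g m)) ≡ false → ∀ k → k < m → f (g k) ≡ false
  or-false f g (suc m) e zero k< with f (g 0) | e
  ... | false | _ = refl
  or-false f g (suc m) e (suc k) (s≤s k<) with f (g 0) | e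
  ... | false | e' = or-false f (g ∘ suc) m e' k k<

  isDesc-sound : ∀ (p : ParentFn n) u v → isDesc p u v ≡ true → Σ ℕ λ k → k < suc n × iter p k v ≡ just u
  isDesc-sound {n} p u v e with or-sound _ id (suc n) e
  ... | k , k<n , ek with iter p k v in eq | ek
  ...   | just w | ew = k , k<n , trans eq (cong just (eqᵇ-sound ew))
  ...   | nothing | ()

  isDesc-complete : ∀ (p : ParentFn n) u v k → k < suc n → iter p k v ≡ just u → isDesc p u v ≡ true
  isDesc-complete {n} p u v k k< e with isDesc p u v in d
  ... | true = refl
  ... | false with iter p k v | or-false _ id (suc n) d k k< | e
  ... | just w | c | refl = ⊥-elim (true≢false (trans (sym (eqᵇ-refl w)) c))

  Ancestor : ParentFn n → Fin n → Fin n → Set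
  Ancestor p u v = Σ ℕ λ k → iter p k v ≡ just u

  isDesc⇒Ancestor : ∀ (p : ParentFn n) u v → isDesc p u v ≡ true → Ancestor p u v
  isDesc⇒Ancestor p u v e = let (k , _ , ek) = isDesc-sound p u v e in k , ek

  Ancestor⇒isDesc : ∀ (p : ParentFn n) → Acyclic p → ∀ u v → Ancestor p u v → isDesc p u v ≡ true
  Ancestor⇒isDesc p ac u v (k , ek) = isDesc-complete p u v k (NP.m≤n⇒m≤1+n (Acyclic-iter-bound p ac k v u ek)) ek

  hook-cong : ∀ (p q : ParentFn n) u u' → Acyclic p → Acyclic q →
    (∀ v → Ancestor p u v → Ancestor q u' v) → (∀ v → Ancestor q u' v → Ancestor p u v) → hook p u ≡ hook q u'
  hook-cong {n} p q u u' ap aq f g = length-filter-cong (isDesc p u) (isDesc q u') (allFin n)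
    (λ v → ⇔→≡ (mk⇔ (λ e → Ancestor⇒isDesc q aq u' v (f v (isDesc⇒Ancestor p u v e)))
                    (λ e → Ancestor⇒isDesc p ap u v (g v (isDesc⇒Ancestor q u' v e)))))

  iter-suc-just : ∀ (p : ParentFn n) k v u → iter p (suc k) v ≡ just u → Σ (Fin n) λ w → lookup p v ≡ just w × iter p k w ≡ just u
  iter-suc-just p k v u e with lookup p v in lv | trans (sym (iter-sucˡ p k v)) e
  ... | just w | e' = w , refl , e'

  iter-cycle : ∀ (p : ParentFn n) d w → iter p d w ≡ just w → ∀ t → iter p (t * d) w ≡ just w
  iter-cycle p d w cyc zero = refl
  iter-cycle p d w cyc (suc t) = trans (iter-+-just p d (t * d) w w cyc) (iter-cycle p d w cyc t)

  private
    visited : ParentFn n → Fin n → Fin n → Fin (suc n) → Fin n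
    visited p v x i = maybe id x (iter p (toℕ i) v)

  -- Pigeonhole on the n + 1 vertices iter p 0 v, …, iter p n v.
  iter-n-just⇒cycle : ∀ (p : ParentFn n) v {x} → iter p n v ≡ just x →
    Σ ℕ λ a → Σ ℕ λ d → d ≢ 0 × Σ (Fin n) λ w → iter p a v ≡ just w × iter p d w ≡ just w
  iter-n-just⇒cycle {n} p v {x} en with FP.pigeonhole (NP.n<1+n n) (visited p v x)
  ... | i , j , i<j , same = toℕ i , toℕ j ∸ toℕ i , NP.m>n⇒m∸n≢0 i<j , visited p v x i , visit i , cycle
    where
    visit : ∀ i → iter p (toℕ i) v ≡ just (visited p v x i)
    visit i with iter p (toℕ i) v in ei
    ... | just y = refl
    ... | nothing = ⊥-elim (just≢nothing (trans (sym en) (iter-nothing-≤ p v (FP.toℕ≤pred[n] i) ei)))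
    cycle : iter p (toℕ j ∸ toℕ i) (visited p v x i) ≡ just (visited p v x i)
    cycle = trans (sym (iter-+-just p (toℕ i) (toℕ j ∸ toℕ i) v _ (visit i)))
      (trans (cong (λ z → iter p z v) (NP.m+[n∸m]≡n (NP.<⇒≤ i<j))) (trans (visit j) (cong just (sym same))))

  iter-nothing⇒iter-n-nothing : ∀ (p : ParentFn n) v → Σ ℕ (λ k → iter p k v ≡ nothing) → iter p n v ≡ nothing
  iter-nothing⇒iter-n-nothing {n} p v (k , ek) with iter p n v in en
  ... | nothing = refl
  ... | just x with iter-n-just⇒cycle p v en
  ...   | a , d , d≢0 , w , ea , cyc = ⊥-elim (just≢nothing (trans (sym periodic) (iter-nothing-≤ p v k≤ ek)))
    where
    periodic : iter p (a + k * d) v ≡ just w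
    periodic = trans (iter-+-just p a (k * d) v w ea) (iter-cycle p d w cyc k)
    k≤ : k ≤ a + k * d
    k≤ = NP.≤-trans (NP.m≤m*n k d {{ℕ.≢-nonZero d≢0}}) (NP.m≤n+m (k * d) a)

module Grafting (N : ℕ) where

  open import Data.Nat using (ℕ; zero; suc; _+_; _∸_)
  import Data.Nat.Properties as NP
  open import Data.Bool using (Bool; true; false; _∧_; not; if_then_else_)
  import Data.Bool.Properties as BP
  open import Data.List.Base using (map; tabulate; allFin; filterᵇ; length)
  open import Data.Bool.ListAction using (and)
  open import Data.Fin as F using (Fin)
  open import Data.Maybe using (Maybe; just; nothing; is-nothing)
  open import Data.Maybe.Base using (_>>=_)
  open import Data.Product using (Σ; _×_; _,_; proj₁; proj₂)
  open import Data.Sum using (_⊎_; inj₁; inj₂)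
  open import Data.Vec as V using (Vec; lookup)
  import Data.Vec.Properties as VP
  open import Data.Empty using (⊥-elim)
  open import Relation.Nullary using (yes; no)
  open import Relation.Binary.PropositionalEquality
  open import Function using (_∘_; id)
  open Sums using (eqᵇ; eqᵇ-sound; eqᵇ-refl; eqᵇ-≢; eqᵇ-false⇒≢; ∧-≡true; length-filter-cong; count-eqᵇ)
  open Ancestry
  open import Data.Rational using (1ℚ) renaming (_*_ to _*ℚ_)
  open import Data.Rational.Properties using (*-identityˡ; *-identityʳ)

  PF : Set
  PF = ParentFn N

  Sub : Set
  Sub = Vec Bool N

  mem : Sub → Fin N → Bool
  mem = lookup

  and-tab : ∀ {n} (f : Fin n → Bool) → and (tabulate f) ≡ true → ∀ i → f i ≡ true
  and-tab {suc n} f e F.zero = proj₁ (∧-≡true e)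
  and-tab {suc n} f e (F.suc i) = and-tab (f ∘ F.suc) (proj₂ (∧-≡true e)) i

  and-tab-intro : ∀ {n} (f : Fin n → Bool) → (∀ i → f i ≡ true) → and (tabulate f) ≡ true
  and-tab-intro {zero} f h = refl
  and-tab-intro {suc n} f h rewrite h F.zero = and-tab-intro (f ∘ F.suc) (h ∘ F.suc)

  and-all : ∀ (f : Fin N → Bool) → and (map f (allFin N)) ≡ true → ∀ i → f i ≡ true
  and-all f e = and-tab f (subst (λ z → and z ≡ true) (LP.map-tabulate id f) e)
    where import Data.List.Properties as LP

  and-all-intro : ∀ (f : Fin N → Bool) → (∀ i → f i ≡ true) → and (map f (allFin N)) ≡ true
  and-all-intro f h = subst (λ z → and z ≡ true) (sym (LP.map-tabulate id f)) (and-tab-intro f h)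
    where import Data.List.Properties as LP

  parentOk : Sub → Bool → Maybe (Fin N) → Bool
  parentOk S true nothing = true
  parentOk S true (just w) = mem S w
  parentOk S false nothing = true
  parentOk S false (just _) = false

  isForestOn : Sub → PF → Bool
  isForestOn S p = and (map (λ u → parentOk S (mem S u) (lookup p u)) (allFin N)) ∧ isForest p

  -- Vertices outside S are isolated roots, so a forest on S contributes weight 1 outside S.
  record ForestOn (S : Sub) (p : PF) : Set where
    field
      root-outside : ∀ u → mem S u ≡ false → lookup p u ≡ nothing
      parent-inside : ∀ u w → lookup p u ≡ just w → mem S w ≡ true
      acyclic : Acyclic p
  open ForestOn public

  is-nothing⇒≡nothing : ∀ {A : Set} (x : Maybe A) → is-nothing x ≡ true → x ≡ nothing
  is-nothing⇒≡nothing nothing e = refl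

  ≡nothing⇒is-nothing : ∀ {A : Set} (x : Maybe A) → x ≡ nothing → is-nothing x ≡ true
  ≡nothing⇒is-nothing nothing e = refl

  isForestOn⇒ForestOn : ∀ S p → isForestOn S p ≡ true → ForestOn S p
  isForestOn⇒ForestOn S p e = record { root-outside = fo ; parent-inside = fi ; acyclic = λ v → is-nothing⇒≡nothing _ (and-all _ e2 v) }
    where
    e1 = proj₁ (∧-≡true e)
    e2 = proj₂ (∧-≡true e)
    ok : ∀ u → parentOk S (mem S u) (lookup p u) ≡ true
    ok = and-all _ e1
    fo : ∀ u → mem S u ≡ false → lookup p u ≡ nothing
    fo u mu with mem S u | lookup p u | ok u
    ... | false | nothing | _ = refl
    fo u () | true | _ | _
    fi : ∀ u w → lookup p u ≡ just w → mem S w ≡ true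
    fi u w lu with mem S u | lookup p u | ok u | lu
    ... | true | just .w | o | refl = o
    ... | false | just .w | () | refl

  ForestOn⇒isForestOn : ∀ S p → ForestOn S p → isForestOn S p ≡ true
  ForestOn⇒isForestOn S p fo = cong₂ _∧_ (and-all-intro _ ok) (and-all-intro _ (λ v → ≡nothing⇒is-nothing _ (acyclic fo v)))
    where
    ok : ∀ u → parentOk S (mem S u) (lookup p u) ≡ true
    ok u with mem S u in mu | lookup p u in lu
    ... | true | nothing = refl
    ... | true | just w = parent-inside fo u w lu
    ... | false | nothing = refl
    ... | false | just w = ⊥-elim (just≢nothing (trans (sym lu) (root-outside fo u mu)))

  iter-target : ∀ {T p} → ForestOn T p → ∀ k v u → iter p k v ≡ just u → u ≡ v ⊎ mem T u ≡ true
  iter-target fo zero v u refl = inj₁ refl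
  iter-target {T} {p} fo (suc k) v u e with iter-suc-just p k v u e
  ... | w , lw , ew with iter-target fo k w u ew
  ... | inj₁ refl = inj₂ (parent-inside fo v u lw)
  ... | inj₂ m = inj₂ m

  iter-source : ∀ {T p} → ForestOn T p → ∀ k v u → iter p k v ≡ just u → v ≡ u ⊎ mem T v ≡ true
  iter-source fo zero v u refl = inj₁ refl
  iter-source {T} {p} fo (suc k) v u e with iter-suc-just p k v u e
  ... | w , lw , ew with mem T v in mv
  ... | true = inj₂ refl
  ... | false = ⊥-elim (just≢nothing (trans (sym lw) (root-outside fo v mv)))

  outside-Ancestor : ∀ {T p} → ForestOn T p → ∀ u → mem T u ≡ false → ∀ v → Ancestor p u v → v ≡ u
  outside-Ancestor fo u mu v (k , e) with iter-target fo k v u e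
  ... | inj₁ refl = refl
  ... | inj₂ m = ⊥-elim (true≢false (trans (sym m) mu))

  root-iter : ∀ (p : PF) r → lookup p r ≡ nothing → ∀ k u → iter p k r ≡ just u → u ≡ r
  root-iter p r lr zero u refl = refl
  root-iter p r lr (suc k) u e with iter-suc-just p k r u e
  ... | w , lw , _ = ⊥-elim (just≢nothing (trans (sym lw) lr))

  iter-mono : ∀ (p q : PF) → (∀ w x → lookup q w ≡ just x → lookup p w ≡ just x) → ∀ k v u → iter q k v ≡ just u → iter p k v ≡ just u
  iter-mono p q s zero v u e = e
  iter-mono p q s (suc k) v u e with iter-suc-just q k v u e
  ... | w , lw , ew = trans (iter-sucˡ p k v) (trans (cong (_>>= iter p k) (s v w lw)) (iter-mono p q s k w u ew))

  Acyclic-mono : ∀ (p q : PF) → (∀ w x → lookup q w ≡ just x → lookup p w ≡ just x) → Acyclic p → Acyclic q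
  Acyclic-mono p q s ap v with iter q N v in e
  ... | nothing = refl
  ... | just u = ⊥-elim (just≢nothing (trans (sym (iter-mono p q s N v u e)) (ap v)))

  _∖_ : Sub → Fin N → Sub
  A ∖ r = V.tabulate (λ u → mem A u ∧ not (eqᵇ u r))

  _−_ : Sub → Sub → Sub
  S − A = V.tabulate (λ u → mem S u ∧ not (mem A u))

  singleton : Fin N → Sub
  singleton m = V.tabulate (λ u → eqᵇ u m)

  mem-∖ : ∀ A r u → mem (A ∖ r) u ≡ mem A u ∧ not (eqᵇ u r)
  mem-∖ A r u = VP.lookup∘tabulate _ u

  mem-− : ∀ S A u → mem (S − A) u ≡ mem S u ∧ not (mem A u)
  mem-− S A u = VP.lookup∘tabulate _ u

  ∖-elim : ∀ A r u → mem (A ∖ r) u ≡ true → mem A u ≡ true × u ≢ r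
  ∖-elim A r u e with mem A u | eqᵇ u r in er | trans (sym (mem-∖ A r u)) e
  ... | true | false | _ = refl , eqᵇ-false⇒≢ er

  ∖-intro : ∀ A r u → mem A u ≡ true → u ≢ r → mem (A ∖ r) u ≡ true
  ∖-intro A r u mu ne = trans (mem-∖ A r u) (cong₂ (λ a b → a ∧ not b) mu (eqᵇ-≢ ne))

  ∖-removes : ∀ A r → mem (A ∖ r) r ≡ false
  ∖-removes A r with mem (A ∖ r) r in e
  ... | false = refl
  ... | true = ⊥-elim (proj₂ (∖-elim A r r e) refl)

  −-elim : ∀ S A u → mem (S − A) u ≡ true → mem S u ≡ true × mem A u ≡ false
  −-elim S A u e with mem S u | mem A u | trans (sym (mem-− S A u)) e
  ... | true | false | _ = refl , refl

  −-intro : ∀ S A u → mem S u ≡ true → mem A u ≡ false → mem (S − A) u ≡ true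
  −-intro S A u ms ma = trans (mem-− S A u) (cong₂ (λ a b → a ∧ not b) ms ma)

  −-removes : ∀ S A u → mem A u ≡ true → mem (S − A) u ≡ false
  −-removes S A u ma = trans (mem-− S A u) (trans (cong (λ b → mem S u ∧ not b) ma) (BP.∧-zeroʳ (mem S u)))

  vec-ext : ∀ {A : Set} {n} (xs ys : Vec A n) → (∀ i → lookup xs i ≡ lookup ys i) → xs ≡ ys
  vec-ext xs ys h = trans (sym (VP.tabulate∘lookup xs)) (trans (VP.tabulate-cong h) (VP.tabulate∘lookup ys))

  hook-leaf : ∀ {T f} → ForestOn T f → ∀ u → mem T u ≡ false → hook f u ≡ length (filterᵇ (λ v → eqᵇ v u) (allFin N))
  hook-leaf {T} {f} fo u mu = length-filter-cong (isDesc f u) (λ v → eqᵇ v u) (allFin N)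
    (λ v → ⇔→≡ (mk⇔ (λ e → subst (λ z → eqᵇ z u ≡ true) (sym (outside-Ancestor fo u mu v (isDesc⇒Ancestor f u v e))) (eqᵇ-refl u))
                    (λ e → Ancestor⇒isDesc f (acyclic fo) u v (0 , cong just (eqᵇ-sound e)))))

  invSq-hook-leaf : ∀ {T f} → ForestOn T f → ∀ u → mem T u ≡ false → invSq (hook f u) ≡ 1ℚ
  invSq-hook-leaf fo u mu = cong invSq (trans (hook-leaf fo u mu) (count-eqᵇ N u))

  card : Sub → ℕ
  card A = length (filterᵇ (mem A) (allFin N))

  orRoot : Fin N → Maybe (Fin N) → Maybe (Fin N)
  orRoot r nothing = just r
  orRoot r (just w) = just w

  graftParent : Bool → Bool → Maybe (Fin N) → Fin N → Maybe (Fin N) → Maybe (Fin N)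
  graftParent true true _ _ _ = nothing
  graftParent true false f1u r _ = orRoot r f1u
  graftParent false _ _ _ f2u = f2u

  -- graft A r f1 f2 makes A a single tree with root r, hanging the roots of f1 below r,
  -- and takes the rest of the forest from f2.
  graft : Sub → Fin N → PF → PF → PF
  graft A r f1 f2 = V.tabulate (λ u → graftParent (mem A u) (eqᵇ u r) (lookup f1 u) r (lookup f2 u))

  record Split (m : Fin N) (S A : Sub) (r : Fin N) (f1 f2 : PF) : Set where
    field
      m∈A : mem A m ≡ true
      A⊆S : ∀ u → mem A u ≡ true → mem S u ≡ true
      r∈A : mem A r ≡ true
      below-root : ForestOn (A ∖ r) f1
      outside-tree : ForestOn (S − A) f2

  module Graft {m S A r f1 f2} (Vd : Split m S A r f1 f2) where
    open Split Vd

    p : PF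
    p = graft A r f1 f2

    lookup-graft : ∀ u → lookup p u ≡ graftParent (mem A u) (eqᵇ u r) (lookup f1 u) r (lookup f2 u)
    lookup-graft u = VP.lookup∘tabulate _ u

    graft-outside : ∀ u → mem A u ≡ false → lookup p u ≡ lookup f2 u
    graft-outside u mu rewrite lookup-graft u | mu = refl

    graft-root : lookup p r ≡ nothing
    graft-root rewrite lookup-graft r | r∈A | eqᵇ-refl r = refl

    graft-inside : ∀ u → mem A u ≡ true → u ≢ r → lookup p u ≡ orRoot r (lookup f1 u)
    graft-inside u mu ne rewrite lookup-graft u | mu | eqᵇ-≢ ne = refl

    graft-below : ∀ u → mem (A ∖ r) u ≡ true → lookup p u ≡ orRoot r (lookup f1 u)
    graft-below u mu = graft-inside u (proj₁ (∖-elim A r u mu)) (proj₂ (∖-elim A r u mu))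

    graft-parent-inside : ∀ v x → mem A v ≡ true → lookup p v ≡ just x →
      v ≢ r × orRoot r (lookup f1 v) ≡ just x
    graft-parent-inside v x mv lx with v F.≟ r
    ... | yes refl = ⊥-elim (just≢nothing (trans (sym lx) graft-root))
    ... | no v≢r = v≢r , trans (sym (graft-inside v mv v≢r)) lx

    iter-outside : ∀ k v → mem A v ≡ false → iter p k v ≡ iter f2 k v
    iter-outside zero v mv = refl
    iter-outside (suc k) v mv = trans (iter-sucˡ p k v)
      (trans (cong (_>>= iter p k) (graft-outside v mv)) (trans (lem (lookup f2 v) refl) (sym (iter-sucˡ f2 k v))))
      where
      lem : ∀ x → lookup f2 v ≡ x → (x >>= iter p k) ≡ (x >>= iter f2 k)
      lem nothing _ = refl
      lem (just x) e = iter-outside k x (proj₂ (−-elim S A x (parent-inside outside-tree v x e)))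

    below→iter : ∀ k v u → mem (A ∖ r) v ≡ true → iter f1 k v ≡ just u → iter p k v ≡ just u
    below→iter zero v u mv e = e
    below→iter (suc k) v u mv e with iter-suc-just f1 k v u e
    ... | w , lw , ew = trans (iter-sucˡ p k v) (trans (cong (_>>= iter p k) pv) (below→iter k w u (parent-inside below-root v w lw) ew))
      where
      pv : lookup p v ≡ just w
      pv = trans (graft-below v mv) (cong (orRoot r) lw)

    iter→below : ∀ k v u → mem (A ∖ r) u ≡ true → iter p k v ≡ just u → iter f1 k v ≡ just u
    iter→below zero v u mu e = e
    iter→below (suc k) v u mu e with iter-suc-just p k v u e
    ... | x , lx , ex = trans (iter-sucˡ f1 k v) (trans (cong (_>>= iter f1 k) (f1-parent (mem A v) refl)) (iter→below k x u mu ex))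
      where
      uA : mem A u ≡ true
      uA = proj₁ (∖-elim A r u mu)
      f1-parent : ∀ b → mem A v ≡ b → lookup f1 v ≡ just x
      f1-parent false mv = ⊥-elim (true≢false (trans (sym uA) uA'))
        where
        xout : mem A x ≡ false
        xout = proj₂ (−-elim S A x (parent-inside outside-tree v x (trans (sym (graft-outside v mv)) lx)))
        uA' : mem A u ≡ false
        uA' with iter-target outside-tree k x u (trans (sym (iter-outside k x xout)) ex)
        ... | inj₁ refl = xout
        ... | inj₂ mm = proj₂ (−-elim S A u mm)
      f1-parent true mv with lookup f1 v | proj₂ (graft-parent-inside v x mv lx)
      ... | just y | e' = e'
      ... | nothing | refl = ⊥-elim (proj₂ (∖-elim A r u mu) (root-iter p r graft-root k u ex))

    iter-closed : ∀ k v u → mem A v ≡ true → iter p k v ≡ just u → mem A u ≡ true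
    iter-closed zero v u mv refl = mv
    iter-closed (suc k) v u mv e with iter-suc-just p k v u e
    ... | x , lx , ex = iter-closed k x u xA ex
      where
      xA : mem A x ≡ true
      xA with lookup f1 v in lf | proj₂ (graft-parent-inside v x mv lx)
      ... | just y | refl = proj₁ (∖-elim A r y (parent-inside below-root v y lf))
      ... | nothing | refl = r∈A

    below⇒Ancestor : ∀ k v → mem (A ∖ r) v ≡ true → iter f1 k v ≡ nothing → Ancestor p r v
    below⇒Ancestor zero v mv ()
    below⇒Ancestor (suc k) v mv e with lookup f1 v in lf | trans (sym (iter-sucˡ f1 k v)) e
    ... | nothing | _ = 1 , trans (graft-below v mv) (cong (orRoot r) lf)
    ... | just w | e' with below⇒Ancestor k w (parent-inside below-root v w lf) e'
    ...   | k' , ek' = suc k' , trans (iter-sucˡ p k' v)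
             (trans (cong (_>>= iter p k') (trans (graft-below v mv) (cong (orRoot r) lf))) ek')

    tree⇒Ancestor : ∀ v → mem A v ≡ true → Ancestor p r v
    tree⇒Ancestor v mv with v F.≟ r
    ... | yes refl = 0 , refl
    ... | no ne = below⇒Ancestor N v (∖-intro A r v mv ne) (acyclic below-root v)

    Ancestor⇒tree : ∀ v → Ancestor p r v → mem A v ≡ true
    Ancestor⇒tree v (k , e) with mem A v in mv
    ... | true = refl
    ... | false with iter-target outside-tree k v r (trans (sym (iter-outside k v mv)) e)
    ...   | inj₁ refl = ⊥-elim (true≢false (trans (sym r∈A) mv))
    ...   | inj₂ mm = ⊥-elim (true≢false (trans (sym r∈A) (proj₂ (−-elim S A r mm))))

    graft-terminates : ∀ v → Σ ℕ λ k → iter p k v ≡ nothing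
    graft-terminates v with mem A v in mv
    ... | false = N , trans (iter-outside N v mv) (acyclic outside-tree v)
    ... | true with tree⇒Ancestor v mv
    ...   | k , ek = k + 1 , trans (iter-+-just p k 1 v r ek) graft-root

    graft-acyclic : Acyclic p
    graft-acyclic v = iter-nothing⇒iter-n-nothing p v (graft-terminates v)

    graft-forest : ForestOn S p
    graft-forest = record { root-outside = fo ; parent-inside = fi ; acyclic = graft-acyclic }
      where
      fo : ∀ u → mem S u ≡ false → lookup p u ≡ nothing
      fo u ms with mem A u in ma
      ... | true = ⊥-elim (true≢false (trans (sym (A⊆S u ma)) ms))
      ... | false = trans (graft-outside u ma) (root-outside outside-tree u (trans (mem-− S A u) (cong (_∧ not (mem A u)) ms)))
      fi : ∀ u w → lookup p u ≡ just w → mem S w ≡ true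
      fi u w lu with mem A u in ma
      ... | false = proj₁ (−-elim S A w (parent-inside outside-tree u w (trans (sym (graft-outside u ma)) lu)))
      ... | true = A⊆S w (iter-closed 1 u w ma lu)

    hook-root : hook p r ≡ length (filterᵇ (mem A) (allFin N))
    hook-root = length-filter-cong (isDesc p r) (mem A) (allFin N)
      (λ v → ⇔→≡ (mk⇔ (λ e → Ancestor⇒tree v (isDesc⇒Ancestor p r v e))
                      (λ e → Ancestor⇒isDesc p graft-acyclic r v (tree⇒Ancestor v e))))

    hook-below : ∀ u → mem (A ∖ r) u ≡ true → hook p u ≡ hook f1 u
    hook-below u mu = hook-cong p f1 u u graft-acyclic (acyclic below-root)
      (λ v a → proj₁ a , iter→below (proj₁ a) v u mu (proj₂ a))
      (λ v a → proj₁ a , below→iter (proj₁ a) v u (v-below v a) (proj₂ a))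
      where
      v-below : ∀ v → Ancestor f1 u v → mem (A ∖ r) v ≡ true
      v-below v (k , e) with iter-source below-root k v u e
      ... | inj₁ refl = mu
      ... | inj₂ mm = mm

    hook-outside : ∀ u → mem A u ≡ false → hook p u ≡ hook f2 u
    hook-outside u mu = hook-cong p f2 u u graft-acyclic (acyclic outside-tree) fwd bwd
      where
      fwd : ∀ v → Ancestor p u v → Ancestor f2 u v
      fwd v (k , e) with mem A v in mv
      ... | true = ⊥-elim (true≢false (trans (sym (iter-closed k v u mv e)) mu))
      ... | false = k , trans (sym (iter-outside k v mv)) e
      bwd : ∀ v → Ancestor f2 u v → Ancestor p u v
      bwd v (k , e) = k , trans (iter-outside k v vout) e
        where
        vout : mem A v ≡ false
        vout with iter-source outside-tree k v u e
        ... | inj₁ refl = mu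
        ... | inj₂ mm = proj₂ (−-elim S A v mm)

    invSq-hook-root : invSq (hook p r) ≡ invSq (card A) *ℚ (invSq (hook f1 r) *ℚ invSq (hook f2 r))
    invSq-hook-root = begin
      invSq (hook p r)                                             ≡⟨ cong invSq hook-root ⟩
      invSq (card A)                                               ≡⟨ sym (*-identityʳ _) ⟩
      invSq (card A) *ℚ 1ℚ                                         ≡⟨ cong (invSq (card A) *ℚ_) (sym (*-identityˡ 1ℚ)) ⟩
      invSq (card A) *ℚ (1ℚ *ℚ 1ℚ)                                 ≡⟨ cong₂ (λ a b → invSq (card A) *ℚ (a *ℚ b)) (sym leaf₁) (sym leaf₂) ⟩
      invSq (card A) *ℚ (invSq (hook f1 r) *ℚ invSq (hook f2 r))   ∎
      where
      open ≡-Reasoning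
      leaf₁ : invSq (hook f1 r) ≡ 1ℚ
      leaf₁ = invSq-hook-leaf below-root r (∖-removes A r)
      leaf₂ : invSq (hook f2 r) ≡ 1ℚ
      leaf₂ = invSq-hook-leaf outside-tree r (−-removes S A r r∈A)

    invSq-hook-graft : ∀ u →
      invSq (hook p u) ≡ (if eqᵇ u r then invSq (card A) else 1ℚ) *ℚ (invSq (hook f1 u) *ℚ invSq (hook f2 u))
    invSq-hook-graft u with eqᵇ u r in er
    ... | true = subst (λ z → invSq (hook p z) ≡ invSq (card A) *ℚ (invSq (hook f1 z) *ℚ invSq (hook f2 z)))
                   (sym (eqᵇ-sound er)) invSq-hook-root
    ... | false with mem A u in ma
    ...   | true = begin
      invSq (hook p u)                                 ≡⟨ cong invSq (hook-below u (∖-intro A r u ma (eqᵇ-false⇒≢ er))) ⟩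
      invSq (hook f1 u)                                ≡⟨ sym (*-identityʳ _) ⟩
      invSq (hook f1 u) *ℚ 1ℚ                          ≡⟨ cong (invSq (hook f1 u) *ℚ_) (sym (invSq-hook-leaf outside-tree u (−-removes S A u ma))) ⟩
      invSq (hook f1 u) *ℚ invSq (hook f2 u)           ≡⟨ sym (*-identityˡ _) ⟩
      1ℚ *ℚ (invSq (hook f1 u) *ℚ invSq (hook f2 u))   ∎
      where open ≡-Reasoning
    ...   | false = begin
      invSq (hook p u)                                 ≡⟨ cong invSq (hook-outside u ma) ⟩
      invSq (hook f2 u)                                ≡⟨ sym (*-identityˡ _) ⟩
      1ℚ *ℚ invSq (hook f2 u)                          ≡⟨ cong (_*ℚ invSq (hook f2 u)) (sym (invSq-hook-leaf below-root u u∉A∖r)) ⟩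
      invSq (hook f1 u) *ℚ invSq (hook f2 u)           ≡⟨ sym (*-identityˡ _) ⟩
      1ℚ *ℚ (invSq (hook f1 u) *ℚ invSq (hook f2 u))   ∎
      where
      open ≡-Reasoning
      u∉A∖r : mem (A ∖ r) u ≡ false
      u∉A∖r = trans (mem-∖ A r u) (cong (_∧ not (eqᵇ u r)) ma)

  cutAt : Bool → Fin N → Maybe (Fin N) → Maybe (Fin N)
  cutAt false r _ = nothing
  cutAt true r nothing = nothing
  cutAt true r (just w) = if eqᵇ w r then nothing else just w

  keepOutside : Bool → Maybe (Fin N) → Maybe (Fin N)
  keepOutside true _ = nothing
  keepOutside false x = x

  find-root : ∀ (p : PF) k v → iter p k v ≡ nothing → Σ (Fin N) λ r → Ancestor p r v × lookup p r ≡ nothing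
  find-root p zero v ()
  find-root p (suc k) v e with lookup p v in lv | trans (sym (iter-sucˡ p k v)) e
  ... | nothing | _ = v , (0 , refl) , lv
  ... | just w | e' with find-root p k w e'
  ...   | r , (k' , ek') , lr = r , (suc k' , trans (iter-sucˡ p k' v) (trans (cong (_>>= iter p k') lv) ek')) , lr

  Ancestor-step : ∀ (p : PF) r u w → lookup p u ≡ just w → Ancestor p r w → Ancestor p r u
  Ancestor-step p r u w lu (k , e) = suc k , trans (iter-sucˡ p k u) (trans (cong (_>>= iter p k) lu) e)

  module Cut {S p} (fo : ForestOn S p) (m : Fin N) (mS : mem S m ≡ true) where
    ac : Acyclic p
    ac = acyclic fo
    root-of-m : Σ (Fin N) λ r → Ancestor p r m × lookup p r ≡ nothing
    root-of-m = find-root p N m (ac m)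
    r : Fin N
    r = proj₁ root-of-m
    r-above-m : Ancestor p r m
    r-above-m = proj₁ (proj₂ root-of-m)
    r-root : lookup p r ≡ nothing
    r-root = proj₂ (proj₂ root-of-m)

    A : Sub
    A = V.tabulate (isDesc p r)

    mem-A : ∀ v → mem A v ≡ isDesc p r v
    mem-A v = VP.lookup∘tabulate _ v

    A⇒Ancestor : ∀ v → mem A v ≡ true → Ancestor p r v
    A⇒Ancestor v e = isDesc⇒Ancestor p r v (trans (sym (mem-A v)) e)

    Ancestor⇒A : ∀ v → Ancestor p r v → mem A v ≡ true
    Ancestor⇒A v a = trans (mem-A v) (Ancestor⇒isDesc p ac r v a)

    f1 : PF
    f1 = V.tabulate (λ u → cutAt (mem A u ∧ not (eqᵇ u r)) r (lookup p u))

    f2 : PF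
    f2 = V.tabulate (λ u → keepOutside (mem A u) (lookup p u))

    lookup-f1 : ∀ u → lookup f1 u ≡ cutAt (mem (A ∖ r) u) r (lookup p u)
    lookup-f1 u = trans (VP.lookup∘tabulate _ u) (cong (λ b → cutAt b r (lookup p u)) (sym (mem-∖ A r u)))

    lookup-f2 : ∀ u → lookup f2 u ≡ keepOutside (mem A u) (lookup p u)
    lookup-f2 u = VP.lookup∘tabulate _ u

    parent-in-tree : ∀ u → mem A u ≡ true → u ≢ r → Σ (Fin N) λ w → lookup p u ≡ just w × mem A w ≡ true
    parent-in-tree u mu ne with A⇒Ancestor u mu
    ... | zero , refl = ⊥-elim (ne refl)
    ... | suc k , e with iter-suc-just p k u r e
    ...   | w , lw , ew = w , lw , Ancestor⇒A w (k , ew)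

    f1⊆p : ∀ w x → lookup f1 w ≡ just x → lookup p w ≡ just x
    f1⊆p w x e with mem (A ∖ r) w | lookup p w | trans (sym (lookup-f1 w)) e
    ... | true | just y | e' with eqᵇ y r
    ...   | false = e'

    f2⊆p : ∀ w x → lookup f2 w ≡ just x → lookup p w ≡ just x
    f2⊆p w x e with mem A w | trans (sym (lookup-f2 w)) e
    ... | false | e' = e'

    f1-forest : ForestOn (A ∖ r) f1
    f1-forest = record { root-outside = fo1 ; parent-inside = fi1 ; acyclic = Acyclic-mono p f1 f1⊆p ac }
      where
      fo1 : ∀ u → mem (A ∖ r) u ≡ false → lookup f1 u ≡ nothing
      fo1 u mu = trans (lookup-f1 u) (cong (λ b → cutAt b r (lookup p u)) mu)
      fi1 : ∀ u w → lookup f1 u ≡ just w → mem (A ∖ r) w ≡ true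
      fi1 u w e with mem (A ∖ r) u in mu | lookup p u in lu | trans (sym (lookup-f1 u)) e
      ... | true | just y | e' with eqᵇ y r in ey | e'
      ...   | false | refl = ∖-intro A r y yA (eqᵇ-false⇒≢ ey)
        where
        yA : mem A y ≡ true
        yA with parent-in-tree u (proj₁ (∖-elim A r u mu)) (proj₂ (∖-elim A r u mu))
        ... | w' , lw' , mw' = subst (λ z → mem A z ≡ true) (just-inj (trans (sym lw') lu)) mw'
          where
          just-inj : ∀ {a b : Fin N} → just a ≡ just b → a ≡ b
          just-inj refl = refl

    f2-forest : ForestOn (S − A) f2
    f2-forest = record { root-outside = fo2 ; parent-inside = fi2 ; acyclic = Acyclic-mono p f2 f2⊆p ac }
      where
      fo2 : ∀ u → mem (S − A) u ≡ false → lookup f2 u ≡ nothing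
      fo2 u mu with mem A u in ma
      ... | true = trans (lookup-f2 u) (cong (λ b → keepOutside b (lookup p u)) ma)
      ... | false = trans (lookup-f2 u) (trans (cong (λ b → keepOutside b (lookup p u)) ma) (root-outside fo u ms))
        where
        ms : mem S u ≡ false
        ms with mem S u in ms'
        ... | false = refl
        ... | true = ⊥-elim (true≢false (trans (sym (−-intro S A u ms' ma)) mu))
      fi2 : ∀ u w → lookup f2 u ≡ just w → mem (S − A) w ≡ true
      fi2 u w e with mem A u in ma | trans (sym (lookup-f2 u)) e
      ... | false | e' = −-intro S A w (parent-inside fo u w e') wout
        where
        wout : mem A w ≡ false
        wout with mem A w in mw
        ... | false = refl
        ... | true = ⊥-elim (true≢false (trans (sym (Ancestor⇒A u (Ancestor-step p r u w e' (A⇒Ancestor w mw)))) ma))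

    split : Split m S A r f1 f2
    split = record { m∈A = Ancestor⇒A m r-above-m ; A⊆S = as ; r∈A = Ancestor⇒A r (0 , refl) ; below-root = f1-forest ; outside-tree = f2-forest }
      where
      rS : mem S r ≡ true
      rS with iter-target fo (proj₁ r-above-m) m r (proj₂ r-above-m)
      ... | inj₁ eq = subst (λ z → mem S z ≡ true) (sym eq) mS
      ... | inj₂ mm = mm
      as : ∀ u → mem A u ≡ true → mem S u ≡ true
      as u mu with iter-source fo (proj₁ (A⇒Ancestor u mu)) u r (proj₂ (A⇒Ancestor u mu))
      ... | inj₁ eq = subst (λ z → mem S z ≡ true) (sym eq) rS
      ... | inj₂ mm = mm

    graft-cut : graft A r f1 f2 ≡ p
    graft-cut = vec-ext _ _ pw
      where
      pw : ∀ u → lookup (graft A r f1 f2) u ≡ lookup p u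
      pw u with mem A u in ma | eqᵇ u r in er
      ... | true | true = trans (VP.lookup∘tabulate _ u) (trans (cong₂ (λ b c → graftParent b c (lookup f1 u) r (lookup f2 u)) ma er)
                           (sym (trans (cong (lookup p) (eqᵇ-sound er)) r-root)))
      ... | false | _ = trans (VP.lookup∘tabulate _ u) (trans (cong (λ b → graftParent b (eqᵇ u r) (lookup f1 u) r (lookup f2 u)) ma)
                           (trans (lookup-f2 u) (cong (λ b → keepOutside b (lookup p u)) ma)))
      ... | true | false with parent-in-tree u ma (eqᵇ-false⇒≢ er)
      ...   | w , lw , _ = trans (VP.lookup∘tabulate _ u) (trans (cong₂ (λ b c → graftParent b c (lookup f1 u) r (lookup f2 u)) ma er)
                             (trans (cong (orRoot r) (trans (lookup-f1 u) (cong₂ (λ b x → cutAt b r x) m∖ lw))) (trans (fin w) (sym lw))))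
        where
        m∖ : mem (A ∖ r) u ≡ true
        m∖ = trans (mem-∖ A r u) (cong₂ (λ a b → a ∧ not b) ma er)
        fin : ∀ w → orRoot r (cutAt true r (just w)) ≡ just w
        fin w with eqᵇ w r in ew
        ... | true = cong just (sym (eqᵇ-sound ew))
        ... | false = refl

  root-unique : ∀ (p : PF) r r' v → Ancestor p r v → Ancestor p r' v → lookup p r ≡ nothing → lookup p r' ≡ nothing → r ≡ r'
  root-unique p r r' v (k , e) (k' , e') lr lr' with NP.≤-total k k'
  ... | inj₁ k≤k' = sym (root-iter p r lr (k' ∸ k) r'
          (trans (sym (iter-+-just p k (k' ∸ k) v r e)) (trans (cong (λ z → iter p z v) (NP.m+[n∸m]≡n k≤k')) e')))
  ... | inj₂ k'≤k = root-iter p r' lr' (k ∸ k') r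
          (trans (sym (iter-+-just p k' (k ∸ k') v r' e')) (trans (cong (λ z → iter p z v) (NP.m+[n∸m]≡n k'≤k)) e))

  orRoot-injective : ∀ r x y → orRoot r x ≡ orRoot r y → x ≢ just r → y ≢ just r → x ≡ y
  orRoot-injective r nothing nothing e nx ny = refl
  orRoot-injective r nothing (just y) refl nx ny = ⊥-elim (ny refl)
  orRoot-injective r (just x) nothing refl nx ny = ⊥-elim (nx refl)
  orRoot-injective r (just x) (just .x) refl nx ny = refl

  graft-injectiveʳ : ∀ {m S A r f1 f2 A' r' f1' f2'} → Split m S A r f1 f2 → Split m S A' r' f1' f2' →
    graft A r f1 f2 ≡ graft A' r' f1' f2' → r ≡ r'
  graft-injectiveʳ {m} {r = r} {r' = r'} V V' same =
    root-unique G.p r r' m (G.tree⇒Ancestor m (Split.m∈A V))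
      (subst (λ q → Ancestor q r' m) (sym same) (G'.tree⇒Ancestor m (Split.m∈A V')))
      G.graft-root (trans (cong (λ q → lookup q r') same) G'.graft-root)
    where
    module G = Graft V
    module G' = Graft V'

  graft-injectiveᵗ : ∀ {m S A r f1 f2 A' f1' f2'} → Split m S A r f1 f2 → Split m S A' r f1' f2' →
    graft A r f1 f2 ≡ graft A' r f1' f2' → A ≡ A'
  graft-injectiveᵗ {A = A} {r} {f1} {f2} {A'} {f1'} {f2'} V V' same = vec-ext A A' (λ v → ⇔→≡ (mk⇔
    (λ e → G'.Ancestor⇒tree v (subst (λ q → Ancestor q r v) same (G.tree⇒Ancestor v e)))
    (λ e → G.Ancestor⇒tree v (subst (λ q → Ancestor q r v) (sym same) (G'.tree⇒Ancestor v e)))))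
    where
    module G = Graft V
    module G' = Graft V'

  graft-injectiveᶠ : ∀ {m S A r f1 f2 f1' f2'} → Split m S A r f1 f2 → Split m S A r f1' f2' →
    graft A r f1 f2 ≡ graft A r f1' f2' → f1 ≡ f1' × f2 ≡ f2'
  graft-injectiveᶠ {S = S} {A} {r} {f1} {f2} {f1'} {f2'} V V' same = vec-ext f1 f1' same-f1 , vec-ext f2 f2' same-f2
    where
    module G = Graft V
    module G' = Graft V'
    open Split
    lookup-same : ∀ u → lookup (graft A r f1 f2) u ≡ lookup (graft A r f1' f2') u
    lookup-same u = cong (λ q → lookup q u) same
    not-r : ∀ {g} → ForestOn (A ∖ r) g → ∀ u → lookup g u ≢ just r
    not-r fo u e = true≢false (trans (sym (parent-inside fo u r e)) (∖-removes A r))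
    same-f1 : ∀ u → lookup f1 u ≡ lookup f1' u
    same-f1 u with mem (A ∖ r) u in mu
    ... | false = trans (root-outside (below-root V) u mu) (sym (root-outside (below-root V') u mu))
    ... | true = orRoot-injective r _ _ (trans (sym (G.graft-below u mu)) (trans (lookup-same u) (G'.graft-below u mu)))
                   (not-r (below-root V) u) (not-r (below-root V') u)
    same-f2 : ∀ u → lookup f2 u ≡ lookup f2' u
    same-f2 u with mem A u in ma
    ... | false = trans (sym (G.graft-outside u ma)) (trans (lookup-same u) (G'.graft-outside u ma))
    ... | true = trans (root-outside (outside-tree V) u (−-removes S A u ma)) (sym (root-outside (outside-tree V') u (−-removes S A u ma)))

  graft-injective : ∀ {m S A r f1 f2 A' r' f1' f2'} → Split m S A r f1 f2 → Split m S A' r' f1' f2' →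
    graft A r f1 f2 ≡ graft A' r' f1' f2' → (A , r , f1 , f2) ≡ (A' , r' , f1' , f2')
  graft-injective V V' same with graft-injectiveʳ V V' same
  ... | refl with graft-injectiveᵗ V V' same
  ...   | refl with graft-injectiveᶠ V V' same
  ...     | refl , refl = refl

module Numerics where

  open import Data.Nat using (ℕ; zero; suc; _+_; _*_; _∸_; _≤_; z≤n; s≤s; _^_; _!; NonZero)
  import Data.Nat.Properties as NP
  open import Data.Integer as ℤ using (+_)
  import Data.Integer.Properties as ZP
  open import Data.Rational as Q using (ℚ; _/_; toℚᵘ)
  import Data.Rational.Properties as QP
  open import Data.Rational.Unnormalised as U using (mkℚᵘ; *≡*)
  import Data.Rational.Unnormalised.Properties as UP
  open import Relation.Binary.PropositionalEquality
  open Sums using (binomialSum; binomialSum-cong)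

  frac : ℕ → (b : ℕ) → .{{NonZero b}} → ℚ
  frac a b = (+ a) / b

  toℚᵘ-frac : ∀ a b → toℚᵘ (frac a (suc b)) U.≃ mkℚᵘ (+ a) b
  toℚᵘ-frac a b = QP.toℚᵘ-fromℚᵘ (mkℚᵘ (+ a) b)

  frac-cross : ∀ a b c d .{{_ : NonZero b}} .{{_ : NonZero d}} → a * d ≡ c * b → frac a b ≡ frac c d
  frac-cross a (suc b) c (suc d) e = QP.toℚᵘ-injective (UP.≃-trans (toℚᵘ-frac a b) (UP.≃-trans (*≡* eq) (UP.≃-sym (toℚᵘ-frac c d))))
    where
    eq : (+ a) ℤ.* (+ suc d) ≡ (+ c) ℤ.* (+ suc b)
    eq = trans (sym (ZP.pos-* a (suc d))) (trans (cong +_ e) (ZP.pos-* c (suc b)))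

  frac-mul : ∀ a b c d .{{_ : NonZero b}} .{{_ : NonZero d}} → frac a b Q.* frac c d ≡ frac (a * c) (b * d) {{NP.m*n≢0 b d}}
  frac-mul a (suc b) c (suc d) = QP.toℚᵘ-injective (UP.≃-trans (QP.toℚᵘ-homo-* (frac a (suc b)) (frac c (suc d)))
    (UP.≃-trans (UP.*-cong (toℚᵘ-frac a b) (toℚᵘ-frac c d)) (UP.≃-trans (UP.≃-reflexive (cong (λ z → mkℚᵘ z (d + b * suc d)) (sym (ZP.pos-* a c))))
       (UP.≃-sym (toℚᵘ-frac (a * c) (d + b * suc d))))))

  frac-add : ∀ a b c d .{{_ : NonZero b}} .{{_ : NonZero d}} → frac a b Q.+ frac c d ≡ frac (a * d + c * b) (b * d) {{NP.m*n≢0 b d}}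
  frac-add a (suc b) c (suc d) = QP.toℚᵘ-injective (UP.≃-trans (QP.toℚᵘ-homo-+ (frac a (suc b)) (frac c (suc d)))
    (UP.≃-trans (UP.+-cong (toℚᵘ-frac a b) (toℚᵘ-frac c d)) (UP.≃-trans (UP.≃-reflexive (cong (λ z → mkℚᵘ z (d + b * suc d)) eq))
       (UP.≃-sym (toℚᵘ-frac (a * suc d + c * suc b) (d + b * suc d))))))
    where
    eq : (+ a) ℤ.* (+ suc d) ℤ.+ (+ c) ℤ.* (+ suc b) ≡ + (a * suc d + c * suc b)
    eq = trans (cong₂ ℤ._+_ (sym (ZP.pos-* a (suc d))) (sym (ZP.pos-* c (suc b)))) (sym (ZP.pos-+ (a * suc d) (c * suc b)))

  open import Data.Nat.Solver using (module +-*-Solver)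
  open +-*-Solver using (solve; _:=_; _:+_; _:*_; con)

  binomialSumℕ : ℕ → (ℕ → ℕ) → ℕ
  binomialSumℕ zero ψ = ψ zero
  binomialSumℕ (suc t) ψ = binomialSumℕ t ψ + binomialSumℕ t (λ k → ψ (suc k))

  binomialSumℕ-cong : ∀ t {ψ ψ' : ℕ → ℕ} → (∀ k → k ≤ t → ψ k ≡ ψ' k) → binomialSumℕ t ψ ≡ binomialSumℕ t ψ'
  binomialSumℕ-cong zero eq = eq zero z≤n
  binomialSumℕ-cong (suc t) eq = cong₂ _+_ (binomialSumℕ-cong t (λ k k≤ → eq k (NP.m≤n⇒m≤1+n k≤)))
                                   (binomialSumℕ-cong t (λ k k≤ → eq (suc k) (s≤s k≤)))

  factorialSum : ℕ → ℕ → ℕ → ℕ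
  factorialSum t i j = binomialSumℕ t (λ k → (k + i) ! * ((t ∸ k) + j) !)

  -- Generalised to arbitrary shifts i, j so that Pascal's rule in t closes the induction;
  -- recurrence-rhs needs only i = 0, j = 1, i.e. ∑ₖ (t choose k) k! (t − k + 1)! = (t + 2)! / 2.
  factorialSum-closed : ∀ t i j → factorialSum t i j * (suc (i + j)) ! ≡ (suc (t + i + j)) ! * (i ! * j !)
  factorialSum-closed zero i j = NP.*-comm (i ! * j !) ((suc (i + j)) !)
  factorialSum-closed (suc t) i j = NP.*-cancelˡ-≡ _ _ c goal
    where
    c = suc (suc (i + j))
    E = (suc (i + j)) !
    F = (suc (suc (t + i + j))) !
    Ii = i !
    Jj = j !
    D1 = factorialSum t i (suc j)
    D2 = factorialSum t (suc i) j
    P1 : binomialSumℕ t (λ k → (k + i) ! * ((suc t ∸ k) + j) !) ≡ D1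
    P1 = binomialSumℕ-cong t (λ k k≤ → cong (λ z → (k + i) ! * z !)
           (trans (cong (_+ j) (NP.+-∸-assoc 1 k≤)) (sym (NP.+-suc (t ∸ k) j))))
    P2 : binomialSumℕ t (λ k → (suc k + i) ! * ((suc t ∸ suc k) + j) !) ≡ D2
    P2 = binomialSumℕ-cong t (λ k k≤ → cong (λ z → z ! * ((t ∸ k) + j) !) (sym (NP.+-suc k i)))
    IH1 : D1 * (c * E) ≡ F * (Ii * (suc j * Jj))
    IH1 = trans (cong (λ z → D1 * (suc z) !) (sym (NP.+-suc i j)))
           (trans (factorialSum-closed t i (suc j)) (cong (λ z → (suc z) ! * (Ii * (suc j * Jj))) (NP.+-suc (t + i) j)))
    IH2 : D2 * (c * E) ≡ F * ((suc i * Ii) * Jj)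
    IH2 = trans (factorialSum-closed t (suc i) j) (cong (λ z → (suc (z + j)) ! * ((suc i * Ii) * Jj)) (NP.+-suc t i))
    goal : c * (factorialSum (suc t) i j * E) ≡ c * (F * (Ii * Jj))
    goal = begin
      c * (factorialSum (suc t) i j * E) ≡⟨ cong (λ z → c * (z * E)) (cong₂ _+_ P1 P2) ⟩
      c * ((D1 + D2) * E) ≡⟨ solve 5 (λ i j d1 d2 e → (con 2 :+ i :+ j) :* ((d1 :+ d2) :* e) := d1 :* ((con 2 :+ i :+ j) :* e) :+ d2 :* ((con 2 :+ i :+ j) :* e)) refl i j D1 D2 E ⟩
      D1 * (c * E) + D2 * (c * E) ≡⟨ cong₂ _+_ IH1 IH2 ⟩
      F * (Ii * (suc j * Jj)) + F * ((suc i * Ii) * Jj) ≡⟨ solve 5 (λ i j f x y → f :* (x :* ((con 1 :+ j) :* y)) :+ f :* (((con 1 :+ i) :* x) :* y) := (con 2 :+ i :+ j) :* (f :* (x :* y))) refl i j F Ii Jj ⟩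
      c * (F * (Ii * Jj)) ∎
      where open ≡-Reasoning

  2^-nonZero : ∀ n → NonZero (2 ^ n)
  2^-nonZero n = NP.m^n≢0 2 n

  recurrence-term : ∀ t k → k ≤ t →
    frac (suc k) 1 Q.* (invSq (suc k) Q.* (rhs k Q.* rhs (t ∸ k))) ≡ frac (k ! * (suc (t ∸ k)) !) (2 ^ t) {{2^-nonZero t}}
  recurrence-term t k k≤ = begin
    frac (suc k) 1 Q.* (frac 1 (suc k * suc k) Q.* (frac A P {{2^-nonZero k}} Q.* frac B Qd {{2^-nonZero (t ∸ k)}}))
      ≡⟨ cong (λ z → frac (suc k) 1 Q.* (frac 1 (suc k * suc k) Q.* z)) (frac-mul A P B Qd {{2^-nonZero k}} {{2^-nonZero (t ∸ k)}}) ⟩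
    frac (suc k) 1 Q.* (frac 1 (suc k * suc k) Q.* frac (A * B) (P * Qd) {{i1}})
      ≡⟨ cong (λ z → frac (suc k) 1 Q.* z) (frac-mul 1 (suc k * suc k) (A * B) (P * Qd) {{_}} {{i1}}) ⟩
    frac (suc k) 1 Q.* frac (1 * (A * B)) (suc k * suc k * (P * Qd)) {{i2}}
      ≡⟨ frac-mul (suc k) 1 (1 * (A * B)) (suc k * suc k * (P * Qd)) {{_}} {{i2}} ⟩
    frac (suc k * (1 * (A * B))) (1 * (suc k * suc k * (P * Qd))) {{NP.m*n≢0 1 _ {{_}} {{i2}}}}
      ≡⟨ frac-cross (suc k * (1 * (A * B))) (1 * (suc k * suc k * (P * Qd))) (k ! * B) (2 ^ t) {{NP.m*n≢0 1 _ {{_}} {{i2}}}} {{2^-nonZero t}} eq ⟩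
    frac (k ! * B) (2 ^ t) {{2^-nonZero t}} ∎
    where
    open ≡-Reasoning
    A = (suc k) !
    B = (suc (t ∸ k)) !
    P = 2 ^ k
    Qd = 2 ^ (t ∸ k)
    i1 = NP.m*n≢0 P Qd {{2^-nonZero k}} {{2^-nonZero (t ∸ k)}}
    i2 = NP.m*n≢0 (suc k * suc k) (P * Qd) {{_}} {{i1}}
    pq : 2 ^ t ≡ P * Qd
    pq = trans (cong (2 ^_) (sym (NP.m+[n∸m]≡n k≤))) (NP.^-distribˡ-+-* 2 k (t ∸ k))
    eq : suc k * (1 * (A * B)) * 2 ^ t ≡ k ! * B * (1 * (suc k * suc k * (P * Qd)))
    eq = trans (cong (suc k * (1 * (A * B)) *_) pq)
           (solve 5 (λ K f b p q → K :* (con 1 :* ((K :* f) :* b)) :* (p :* q) := f :* b :* (con 1 :* (K :* K :* (p :* q)))) refl (suc k) (k !) B P Qd)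

  binomialSum-frac : ∀ t (ψ : ℕ → ℕ) d .{{_ : NonZero d}} → binomialSum t (λ k → frac (ψ k) d) ≡ frac (binomialSumℕ t ψ) d
  binomialSum-frac zero ψ d = refl
  binomialSum-frac (suc t) ψ d = trans (cong₂ Q._+_ (binomialSum-frac t ψ d) (binomialSum-frac t (λ k → ψ (suc k)) d))
    (trans (frac-add (binomialSumℕ t ψ) d (binomialSumℕ t (λ k → ψ (suc k))) d)
      (frac-cross (binomialSumℕ t ψ * d + binomialSumℕ t (λ k → ψ (suc k)) * d) (d * d) (binomialSumℕ t ψ + binomialSumℕ t (λ k → ψ (suc k))) d {{NP.m*n≢0 d d}} (solve 3 (λ a c d → (a :* d :+ c :* d) :* d := (a :+ c) :* (d :* d)) refl (binomialSumℕ t ψ) (binomialSumℕ t (λ k → ψ (suc k))) d)))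

  recurrence-rhs : ∀ t → binomialSum t (λ k → frac (suc k) 1 Q.* (invSq (suc k) Q.* (rhs k Q.* rhs (t ∸ k)))) ≡ rhs (suc t)
  recurrence-rhs t = begin
    binomialSum t (λ k → frac (suc k) 1 Q.* (invSq (suc k) Q.* (rhs k Q.* rhs (t ∸ k))))
      ≡⟨ binomialSum-cong t (λ k k≤ → recurrence-term t k k≤) ⟩
    binomialSum t (λ k → frac (ψ k) (2 ^ t) {{2^-nonZero t}})
      ≡⟨ binomialSum-frac t ψ (2 ^ t) {{2^-nonZero t}} ⟩
    frac (binomialSumℕ t ψ) (2 ^ t) {{2^-nonZero t}}
      ≡⟨ frac-cross (binomialSumℕ t ψ) (2 ^ t) ((suc (suc t)) !) (2 ^ suc t) {{2^-nonZero t}} {{2^-nonZero (suc t)}} eq ⟩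
    frac ((suc (suc t)) !) (2 ^ suc t) {{2^-nonZero (suc t)}} ∎
    where
    open ≡-Reasoning
    ψ : ℕ → ℕ
    ψ k = k ! * (suc (t ∸ k)) !
    bd : binomialSumℕ t ψ ≡ factorialSum t 0 1
    bd = binomialSumℕ-cong t (λ k _ → cong₂ (λ a b → a ! * b !) (sym (NP.+-identityʳ k)) (NP.+-comm 1 (t ∸ k)))
    d2 : binomialSumℕ t ψ * 2 ≡ (suc (suc t)) !
    d2 = trans (cong (_* 2) bd) (trans (factorialSum-closed t 0 1)
           (trans (cong (λ z → (suc z) ! * 1) (trans (cong (_+ 1) (NP.+-identityʳ t)) (NP.+-comm t 1))) (NP.*-identityʳ _)))
    eq : binomialSumℕ t ψ * 2 ^ suc t ≡ (suc (suc t)) ! * 2 ^ t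
    eq = trans (sym (NP.*-assoc (binomialSumℕ t ψ) 2 (2 ^ t))) (cong (_* 2 ^ t) d2)

module ForestSums (N : ℕ) where

  open import Data.Nat as ℕ using (ℕ; zero; suc; _∸_; _≤_; _<_; z≤n; s≤s)
  import Data.Nat.Properties as NP
  open import Data.Bool using (Bool; true; false; _∧_; not; if_then_else_)
  import Data.Bool.Properties as BP
  open import Data.List.Base using (List; []; _∷_; map; allFin; filterᵇ; length)
  open import Data.Fin as F using (Fin)
  import Data.Fin.Properties as FP
  open import Data.Maybe using (just; nothing)
  open import Data.Product using (Σ; _×_; _,_; proj₁; proj₂)
  open import Data.Vec as V using (Vec; []; _∷_; lookup)
  import Data.Vec.Properties as VP
  import Data.List.Properties as LP
  open import Data.Nat.Induction using (<-rec)
  open import Data.Empty using (⊥-elim)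
  open import Relation.Nullary using (yes; no)
  open import Relation.Binary.PropositionalEquality hiding ([_])
  open import Function using (_∘_; id)
  open import Data.Rational using (ℚ; 1ℚ; _+_; _*_)
  open import Data.Rational.Properties
  open import Data.Rational.Solver
  open +-*-Solver
  open Sums
  open Ancestry
  open Grafting N
  open Numerics using (frac; frac-add; frac-cross; recurrence-rhs)

  enumParentFn : Enumeration PF
  enumParentFn = enumVec (enumMaybeFin N) N

  enumSubset : Enumeration Sub
  enumSubset = enumVec enumBool N

  enumSplitData : Enumeration (Sub × (Fin N × (PF × PF)))
  enumSplitData = enum× enumSubset (enum× (enumFin N) (enum× enumParentFn enumParentFn))

  parentFns : List PF
  parentFns = elements enumParentFn

  forestSum : Sub → ℚ
  forestSum T = ∑ parentFns (λ p → [ isForestOn T p ] * weight p)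

  isSubset⇒⊆ : ∀ {n} (A S : Vec Bool n) → isSubset A S ≡ true → ∀ u → lookup A u ≡ true → lookup S u ≡ true
  isSubset⇒⊆ (true ∷ A) (true ∷ S) e F.zero mu = refl
  isSubset⇒⊆ (a ∷ A) (s ∷ S) e (F.suc u) mu = isSubset⇒⊆ A S (proj₂ (∧-≡true e)) u mu

  ⊆⇒isSubset : ∀ {n} (A S : Vec Bool n) → (∀ u → lookup A u ≡ true → lookup S u ≡ true) → isSubset A S ≡ true
  ⊆⇒isSubset [] [] h = refl
  ⊆⇒isSubset (false ∷ A) (s ∷ S) h = ⊆⇒isSubset A S (h ∘ F.suc)
  ⊆⇒isSubset (true ∷ A) (s ∷ S) h rewrite h F.zero refl = ⊆⇒isSubset A S (h ∘ F.suc)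

  isSubset-singleton : ∀ m A → isSubset (singleton m) A ≡ mem A m
  isSubset-singleton m A = ⇔→≡ (mk⇔ (λ e → isSubset⇒⊆ (singleton m) A e m (trans (VP.lookup∘tabulate _ m) (eqᵇ-refl m)))
    (λ e → ⊆⇒isSubset (singleton m) A (λ u eu → subst (λ z → mem A z ≡ true) (sym (eqᵇ-sound (trans (sym (VP.lookup∘tabulate _ u)) eu))) e)))

  card≡countTrue : ∀ {n} (A : Vec Bool n) → length (filterᵇ (lookup A) (allFin n)) ≡ countTrue A
  card≡countTrue [] = refl
  card≡countTrue {suc n} (true ∷ A) = cong suc (trans (length-filter-tabulate n (lookup (true ∷ A)) F.suc) (card≡countTrue A))
  card≡countTrue {suc n} (false ∷ A) = trans (length-filter-tabulate n (lookup (false ∷ A)) F.suc) (card≡countTrue A)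

  card-∖ : ∀ A r → mem A r ≡ true → card (A ∖ r) ℕ.+ 1 ≡ card A
  card-∖ A r mr =
    trans (cong₂ ℕ._+_ (length-filter-cong (mem (A ∖ r)) (λ u → mem A u ∧ not (eqᵇ u r)) (allFin N) (mem-∖ A r))
                       (sym (count-eqᵇ N r)))
    (length-filter-split (mem A) (λ u → eqᵇ u r) (allFin N) (λ u e → subst (λ z → mem A z ≡ true) (sym (eqᵇ-sound e)) mr))

  card-− : ∀ S A → (∀ u → mem A u ≡ true → mem S u ≡ true) → card (S − A) ℕ.+ card A ≡ card S
  card-− S A h = trans (cong (ℕ._+ card A) (length-filter-cong (mem (S − A)) (λ u → mem S u ∧ not (mem A u)) (allFin N) (mem-− S A)))
    (length-filter-split (mem S) (mem A) (allFin N) h)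

  card-singleton : ∀ m → card (singleton m) ≡ 1
  card-singleton m = trans (length-filter-cong (mem (singleton m)) (λ v → eqᵇ v m) (allFin N) (λ u → VP.lookup∘tabulate _ u)) (count-eqᵇ N m)

  mem⇒card≥1 : ∀ S m → mem S m ≡ true → 1 ≤ card S
  mem⇒card≥1 S m e = subst (1 ≤_) (card-∖ S m e) (NP.m≤n+m 1 _)

  weight-graft : ∀ {m S A r f1 f2} → Split m S A r f1 f2 → weight (graft A r f1 f2) ≡ invSq (card A) * (weight f1 * weight f2)
  weight-graft {m} {S} {A} {r} {f1} {f2} V = trans (∏-cong (allFin N) (Graft.invSq-hook-graft V))
    (trans (∏-* (allFin N) (λ u → if eqᵇ u r then invSq (card A) else 1ℚ) (λ u → invSq (hook f1 u) * invSq (hook f2 u)))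
      (cong₂ _*_ (∏-δ N r (invSq (card A))) (∏-* (allFin N) (λ u → invSq (hook f1 u)) (λ u → invSq (hook f2 u)))))

  ∑-count : ∀ {B : Set} (xs : List B) (f : B → Bool) → ∑ xs (λ x → [ f x ]) ≡ frac (length (filterᵇ f xs)) 1
  ∑-count [] f = refl
  ∑-count (x ∷ xs) f with f x
  ... | true = trans (cong (1ℚ +_) (∑-count xs f)) (trans (frac-add 1 1 n 1)
                 (frac-cross (1 ℕ.* 1 ℕ.+ n ℕ.* 1) (1 ℕ.* 1) (suc n) 1 (cong (λ z → suc z ℕ.* 1) (NP.*-identityʳ n))))
    where
    n : ℕ
    n = length (filterᵇ f xs)
  ... | false = trans (+-identityˡ _) (∑-count xs f)

  module Recurrence (S : Sub) (m : Fin N) (mS : mem S m ≡ true) where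
    Y : Set
    Y = Sub × (Fin N × (PF × PF))

    isSplit : Y → Bool
    isSplit (A , r , f1 , f2) = isSubset (singleton m) A ∧ (isSubset A S ∧ (mem A r ∧ (isForestOn (A ∖ r) f1 ∧ isForestOn (S − A) f2)))

    φ : Y → PF
    φ (A , r , f1 , f2) = graft A r f1 f2

    isSplit⇒Split : ∀ A r f1 f2 → isSplit (A , r , f1 , f2) ≡ true → Split m S A r f1 f2
    isSplit⇒Split A r f1 f2 q = record
      { m∈A = trans (sym (isSubset-singleton m A)) (proj₁ q1)
      ; A⊆S = isSubset⇒⊆ A S (proj₁ q2)
      ; r∈A = proj₁ q3
      ; below-root = isForestOn⇒ForestOn (A ∖ r) f1 (proj₁ q4)
      ; outside-tree = isForestOn⇒ForestOn (S − A) f2 (proj₂ q4) }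
      where
      b1 = isForestOn (A ∖ r) f1
      b2 = isForestOn (S − A) f2
      q1 = ∧-≡true {isSubset (singleton m) A} {isSubset A S ∧ (mem A r ∧ (b1 ∧ b2))} q
      q2 = ∧-≡true {isSubset A S} {mem A r ∧ (b1 ∧ b2)} (proj₂ q1)
      q3 = ∧-≡true {mem A r} {b1 ∧ b2} (proj₂ q2)
      q4 = ∧-≡true {b1} {b2} (proj₂ q3)

    Split⇒isSplit : ∀ {A r f1 f2} → Split m S A r f1 f2 → isSplit (A , r , f1 , f2) ≡ true
    Split⇒isSplit {A} {r} {f1} {f2} V = cong₂ _∧_ (trans (isSubset-singleton m A) (Split.m∈A V))
      (cong₂ _∧_ (⊆⇒isSubset A S (Split.A⊆S V)) (cong₂ _∧_ (Split.r∈A V)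
        (cong₂ _∧_ (ForestOn⇒isForestOn (A ∖ r) f1 (Split.below-root V)) (ForestOn⇒isForestOn (S − A) f2 (Split.outside-tree V)))))

    forestSum-splits : forestSum S ≡ ∑ (elements enumSplitData) (λ y → [ isSplit y ] * weight (φ y))
    forestSum-splits = ∑-reindex enumParentFn enumSplitData (isForestOn S) isSplit φ φ-maps φ-injective φ-surjective weight
      where
      φ-maps : ∀ y → isSplit y ≡ true → isForestOn S (φ y) ≡ true
      φ-maps (A , r , f1 , f2) q = ForestOn⇒isForestOn S _ (Graft.graft-forest (isSplit⇒Split A r f1 f2 q))
      φ-injective : ∀ y y' → isSplit y ≡ true → isSplit y' ≡ true → φ y ≡ φ y' → y ≡ y'
      φ-injective (A , r , f1 , f2) (A' , r' , f1' , f2') q q' =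
        graft-injective (isSplit⇒Split A r f1 f2 q) (isSplit⇒Split A' r' f1' f2' q')
      φ-surjective : ∀ p → isForestOn S p ≡ true → Σ Y λ y → isSplit y ≡ true × φ y ≡ p
      φ-surjective p fp = (E.A , E.r , E.f1 , E.f2) , Split⇒isSplit E.split , E.graft-cut
        where module E = Cut (isForestOn⇒ForestOn S p fp) m mS

    subsets : List Sub
    subsets = elements enumSubset

    vertices : List (Fin N)
    vertices = allFin N

    splitWeight : Y → ℚ
    splitWeight (A , r , f1 , f2) = [ isSplit (A , r , f1 , f2) ] * (invSq (card A) * (weight f1 * weight f2))

    ∑-splits-graft-weight : ∑ (elements enumSplitData) (λ y → [ isSplit y ] * weight (φ y)) ≡ ∑ (elements enumSplitData) splitWeight
    ∑-splits-graft-weight = ∑-cong (elements enumSplitData) pw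
      where
      pw : ∀ y → [ isSplit y ] * weight (φ y) ≡ splitWeight y
      pw (A , r , f1 , f2) = []*-cong (isSplit (A , r , f1 , f2)) (λ q → weight-graft (isSplit⇒Split A r f1 f2 q))

    ∑-splitData : ∑ (elements enumSplitData) splitWeight
      ≡ ∑ subsets (λ A → ∑ vertices (λ r → ∑ parentFns (λ f1 → ∑ parentFns (λ f2 → splitWeight (A , r , f1 , f2)))))
    ∑-splitData = trans (∑-pairs subsets _ splitWeight)
      (∑-cong subsets (λ A → trans (∑-pairs vertices _ _) (∑-cong vertices (λ r → ∑-pairs parentFns parentFns _))))

    ∑-split-forests : ∀ A r → ∑ parentFns (λ f1 → ∑ parentFns (λ f2 → splitWeight (A , r , f1 , f2))) ≡
      [ isSubset (singleton m) A ∧ (isSubset A S ∧ mem A r) ] * (invSq (card A) * (forestSum (A ∖ r) * forestSum (S − A)))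
    ∑-split-forests A r = begin
      ∑ parentFns (λ f1 → ∑ parentFns (λ f2 → splitWeight (A , r , f1 , f2)))
        ≡⟨ ∑-cong parentFns (λ f1 → ∑-cong parentFns (λ f2 → splitWeight-factors f1 f2)) ⟩
      ∑ parentFns (λ f1 → ∑ parentFns (λ f2 → (c * weight-below f1) * weight-outside f2))
        ≡⟨ ∑-cong parentFns (λ f1 → ∑-*ˡ parentFns (c * weight-below f1) weight-outside) ⟩
      ∑ parentFns (λ f1 → (c * weight-below f1) * ∑ parentFns weight-outside)
        ≡⟨ ∑-*ʳ parentFns (∑ parentFns weight-outside) (λ f1 → c * weight-below f1) ⟩
      ∑ parentFns (λ f1 → c * weight-below f1) * ∑ parentFns weight-outside
        ≡⟨ cong (_* ∑ parentFns weight-outside) (∑-*ˡ parentFns c weight-below) ⟩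
      (c * ∑ parentFns weight-below) * ∑ parentFns weight-outside
        ≡⟨ *-assoc c (∑ parentFns weight-below) (∑ parentFns weight-outside) ⟩
      c * (forestSum (A ∖ r) * forestSum (S − A))
        ≡⟨ *-assoc [ a ] (invSq (card A)) _ ⟩
      [ a ] * (invSq (card A) * (forestSum (A ∖ r) * forestSum (S − A))) ∎
      where
      open ≡-Reasoning
      a1 = isSubset (singleton m) A
      a2 = isSubset A S
      a3 = mem A r
      a = a1 ∧ (a2 ∧ a3)
      c = [ a ] * invSq (card A)
      weight-below : PF → ℚ
      weight-below f1 = [ isForestOn (A ∖ r) f1 ] * weight f1
      weight-outside : PF → ℚ
      weight-outside f2 = [ isForestOn (S − A) f2 ] * weight f2
      splitWeight-factors : ∀ f1 f2 → splitWeight (A , r , f1 , f2) ≡ (c * weight-below f1) * weight-outside f2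
      splitWeight-factors f1 f2 = begin
        [ a1 ∧ (a2 ∧ (a3 ∧ (b1 ∧ b2))) ] * (i * (w1 * w2))
          ≡⟨ cong (_* (i * (w1 * w2))) (trans ([∧] a1 _) (cong ([ a1 ] *_) (trans ([∧] a2 _) (cong ([ a2 ] *_) (trans ([∧] a3 _) (cong ([ a3 ] *_) ([∧] b1 b2))))))) ⟩
        ([ a1 ] * ([ a2 ] * ([ a3 ] * ([ b1 ] * [ b2 ])))) * (i * (w1 * w2))
          ≡⟨ solve 8 (λ x1 x2 x3 y1 y2 ii z1 z2 → (x1 :* (x2 :* (x3 :* (y1 :* y2)))) :* (ii :* (z1 :* z2)) := ((x1 :* (x2 :* x3)) :* ii :* (y1 :* z1)) :* (y2 :* z2)) refl [ a1 ] [ a2 ] [ a3 ] [ b1 ] [ b2 ] i w1 w2 ⟩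
        (([ a1 ] * ([ a2 ] * [ a3 ])) * i * weight-below f1) * weight-outside f2
          ≡⟨ cong (λ z → (z * i * weight-below f1) * weight-outside f2) (sym (trans ([∧] a1 _) (cong ([ a1 ] *_) ([∧] a2 a3)))) ⟩
        (c * weight-below f1) * weight-outside f2 ∎
        where
        b1 = isForestOn (A ∖ r) f1
        b2 = isForestOn (S − A) f2
        i = invSq (card A)
        w1 = weight f1
        w2 = weight f2

    module Step (t : ℕ) (eS : card S ≡ suc t) (IH : ∀ T → card T < card S → forestSum T ≡ rhs (card T)) where
      -- The contribution of the trees of size a: a choices of root, the factor 1/a² of the
      -- root's hook, and by induction the forests on a − 1 and on |S| − a vertices.
      Φ : ℕ → ℚ
      Φ a = frac a 1 * (invSq a * (rhs (a ∸ 1) * rhs (suc t ∸ a)))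

      ∑-split-roots : ∀ A →
        ∑ vertices (λ r → [ isSubset (singleton m) A ∧ (isSubset A S ∧ mem A r) ] * (invSq (card A) * (forestSum (A ∖ r) * forestSum (S − A))))
                    ≡ [ isSubset (singleton m) A ∧ isSubset A S ] * Φ (countTrue A)
      ∑-split-roots A = begin
        ∑ vertices (λ r → [ a1 ∧ (a2 ∧ mem A r) ] * (invSq (card A) * (forestSum (A ∖ r) * forestSum (S − A))))
          ≡⟨ ∑-cong vertices (λ r → []*-cong (a1 ∧ (a2 ∧ mem A r)) (λ q → cong (invSq (card A) *_) (forestSum-parts r q))) ⟩
        ∑ vertices (λ r → [ a1 ∧ (a2 ∧ mem A r) ] * K)
          ≡⟨ ∑-cong vertices (λ r → trans (cong (_* K) (trans ([∧] a1 _) (trans (cong ([ a1 ] *_) ([∧] a2 (mem A r)))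
                                (sym (trans (cong (_* [ mem A r ]) ([∧] a1 a2)) (*-assoc [ a1 ] [ a2 ] [ mem A r ]))))))
                                (*-assoc [ a1 ∧ a2 ] [ mem A r ] K)) ⟩
        ∑ vertices (λ r → [ a1 ∧ a2 ] * ([ mem A r ] * K))
          ≡⟨ ∑-*ˡ vertices [ a1 ∧ a2 ] (λ r → [ mem A r ] * K) ⟩
        [ a1 ∧ a2 ] * ∑ vertices (λ r → [ mem A r ] * K)
          ≡⟨ cong ([ a1 ∧ a2 ] *_) (trans (∑-*ʳ vertices K (λ r → [ mem A r ])) (cong (_* K) (∑-count vertices (mem A)))) ⟩
        [ a1 ∧ a2 ] * Φ (card A)
          ≡⟨ cong (λ z → [ a1 ∧ a2 ] * Φ z) (card≡countTrue A) ⟩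
        [ a1 ∧ a2 ] * Φ (countTrue A) ∎
        where
        open ≡-Reasoning
        a1 = isSubset (singleton m) A
        a2 = isSubset A S
        K = invSq (card A) * (rhs (card A ∸ 1) * rhs (suc t ∸ card A))
        forestSum-parts : ∀ r → a1 ∧ (a2 ∧ mem A r) ≡ true →
          forestSum (A ∖ r) * forestSum (S − A) ≡ rhs (card A ∸ 1) * rhs (suc t ∸ card A)
        forestSum-parts r q = cong₂ _*_ g1 g2
          where
          q1 = ∧-≡true {a1} {a2 ∧ mem A r} q
          q2 = ∧-≡true {a2} {mem A r} (proj₂ q1)
          mA : mem A m ≡ true
          mA = trans (sym (isSubset-singleton m A)) (proj₁ q1)
          AS : ∀ u → mem A u ≡ true → mem S u ≡ true
          AS = isSubset⇒⊆ A S (proj₁ q2)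
          mr : mem A r ≡ true
          mr = proj₂ q2
          e1 : card (A ∖ r) ℕ.+ 1 ≡ card A
          e1 = card-∖ A r mr
          e2 : card (S − A) ℕ.+ card A ≡ card S
          e2 = card-− S A AS
          A≥1 : 1 ≤ card A
          A≥1 = mem⇒card≥1 A m mA
          A≤S : card A ≤ card S
          A≤S = subst (card A ≤_) e2 (NP.m≤n+m (card A) (card (S − A)))
          lt1 : card (A ∖ r) < card S
          lt1 = NP.<-≤-trans (subst (card (A ∖ r) <_) e1 (NP.m<m+n (card (A ∖ r)) (s≤s z≤n))) A≤S
          lt2 : card (S − A) < card S
          lt2 = subst (card (S − A) <_) e2 (NP.m<m+n (card (S − A)) A≥1)
          g1 : forestSum (A ∖ r) ≡ rhs (card A ∸ 1)
          g1 = trans (IH (A ∖ r) lt1) (cong rhs (trans (sym (NP.m+n∸n≡m (card (A ∖ r)) 1)) (cong (_∸ 1) e1)))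
          g2 : forestSum (S − A) ≡ rhs (suc t ∸ card A)
          g2 = trans (IH (S − A) lt2) (cong rhs (trans (sym (NP.m+n∸n≡m (card (S − A)) (card A))) (cong (_∸ card A) (trans e2 eS))))

      ∑-split-trees : ∑ subsets (λ A → [ isSubset (singleton m) A ∧ isSubset A S ] * Φ (countTrue A)) ≡ rhs (suc t)
      ∑-split-trees = begin
        ∑ subsets (λ A → [ isSubset (singleton m) A ∧ isSubset A S ] * Φ (countTrue A))
          ≡⟨ ∑-between-binomialSum N (singleton m) S Φ (trans (isSubset-singleton m S) mS) ⟩
        binomialSum (countTrue S ∸ countTrue (singleton m)) (λ k → Φ (countTrue (singleton m) ℕ.+ k))
          ≡⟨ cong₂ (λ a b → binomialSum (a ∸ b) (λ k → Φ (b ℕ.+ k))) |S| |m| ⟩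
        binomialSum t (λ k → Φ (suc k))
          ≡⟨ recurrence-rhs t ⟩
        rhs (suc t) ∎
        where
        open ≡-Reasoning
        |S| : countTrue S ≡ suc t
        |S| = trans (sym (card≡countTrue S)) eS
        |m| : countTrue (singleton m) ≡ 1
        |m| = trans (sym (card≡countTrue (singleton m))) (card-singleton m)

      forestSum-suc : forestSum S ≡ rhs (suc t)
      forestSum-suc = begin
        forestSum S ≡⟨ forestSum-splits ⟩
        _ ≡⟨ ∑-splits-graft-weight ⟩
        _ ≡⟨ ∑-splitData ⟩
        ∑ subsets (λ A → ∑ vertices (λ r → ∑ parentFns (λ f1 → ∑ parentFns (λ f2 → splitWeight (A , r , f1 , f2)))))
          ≡⟨ ∑-cong subsets (λ A → trans (∑-cong vertices (λ r → ∑-split-forests A r)) (∑-split-roots A)) ⟩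
        ∑ subsets (λ A → [ isSubset (singleton m) A ∧ isSubset A S ] * Φ (countTrue A))
          ≡⟨ ∑-split-trees ⟩
        rhs (suc t) ∎
        where open ≡-Reasoning

  allRoots : PF
  allRoots = V.replicate N nothing

  lookup-allRoots : ∀ u → lookup allRoots u ≡ nothing
  lookup-allRoots u = VP.lookup-replicate u nothing

  allRoots-forest : ∀ S → ForestOn S allRoots
  allRoots-forest S = record
    { root-outside = λ u _ → lookup-allRoots u
    ; parent-inside = λ u w e → ⊥-elim (just≢nothing (trans (sym e) (lookup-allRoots u)))
    ; acyclic = λ v → iter-nothing⇒iter-n-nothing allRoots v (1 , lookup-allRoots v) }

  forestSum-zero : ∀ S → card S ≡ 0 → forestSum S ≡ rhs 0
  forestSum-zero S e0 = trans (∑-cong parentFns only-allRoots) (∑-δ enumParentFn allRoots (λ _ → 1ℚ))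
    where
    outside : ∀ u → mem S u ≡ false
    outside u = BP.¬-not (λ mu → NP.n≮n 0 (subst (1 ≤_) e0 (mem⇒card≥1 S u mu)))
    isForestOn≡allRoots : ∀ p → isForestOn S p ≡ equal enumParentFn p allRoots
    isForestOn≡allRoots p = ⇔→≡ (mk⇔
      (λ e → subst (λ z → equal enumParentFn p z ≡ true)
        (vec-ext p allRoots (λ u → trans (root-outside (isForestOn⇒ForestOn S p e) u (outside u)) (sym (lookup-allRoots u))))
        (equal-refl enumParentFn p))
      (λ e → subst (λ z → isForestOn S z ≡ true) (sym (equal-sound enumParentFn e))
        (ForestOn⇒isForestOn S allRoots (allRoots-forest S))))
    weight-allRoots : weight allRoots ≡ 1ℚ
    weight-allRoots = trans (∏-cong (allFin N) (λ u → invSq-hook-leaf (allRoots-forest S) u (outside u))) (∏-1 (allFin N))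
    only-allRoots : ∀ p → [ isForestOn S p ] * weight p ≡ [ equal enumParentFn p allRoots ] * 1ℚ
    only-allRoots p = trans (cong (λ b → [ b ] * weight p) (isForestOn≡allRoots p))
      ([]*-cong (equal enumParentFn p allRoots) (λ e → trans (cong weight (equal-sound enumParentFn e)) weight-allRoots))

  forestSum≡rhs : ∀ S → forestSum S ≡ rhs (card S)
  forestSum≡rhs S = <-rec (λ s → ∀ S → card S ≡ s → forestSum S ≡ rhs s) step (card S) S refl
    where
    step : ∀ s → (∀ {s'} → s' < s → ∀ S → card S ≡ s' → forestSum S ≡ rhs s') → ∀ S → card S ≡ s → forestSum S ≡ rhs s
    step zero rec S e = forestSum-zero S e
    step (suc t) rec S e with FP.any? (λ u → mem S u Data.Bool.≟ true)
    ... | yes (m , mS) = Recurrence.Step.forestSum-suc S m mS t e (λ T lt → rec (subst (card T <_) e lt) T refl)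
    ... | no ∉S = ⊥-elim (NP.1+n≢0 (trans (sym e) (length-filter-none (mem S) (allFin N) (λ u → BP.¬-not (λ mu → ∉S (u , mu))))))

  everything : Sub
  everything = V.replicate N true

  card-everything : card everything ≡ N
  card-everything = trans (length-filter-all (mem everything) (allFin N) (λ u → VP.lookup-replicate u true))
    (LP.length-tabulate id)

  isForestOn-everything : ∀ p → isForestOn everything p ≡ isForest p
  isForestOn-everything p = cong (_∧ isForest p) (and-all-intro _ parent-ok)
    where
    parent-ok : ∀ u → parentOk everything (mem everything u) (lookup p u) ≡ true
    parent-ok u rewrite VP.lookup-replicate u true with lookup p u
    ... | nothing = refl
    ... | just w = VP.lookup-replicate w true

  sum-forests≡forestSum : sumℚ (map weight (forests N)) ≡ forestSum everything
  sum-forests≡forestSum = begin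
    sumℚ (map weight (filterᵇ isForest (allVecs N N)))  ≡⟨ ∑-filterᵇ isForest weight (allVecs N N) ⟩
    ∑ (allVecs N N) (λ p → [ isForest p ] * weight p)   ≡⟨ cong (λ L → ∑ L (λ p → [ isForest p ] * weight p)) (allVecs≡vectors N N) ⟩
    ∑ parentFns (λ p → [ isForest p ] * weight p)       ≡⟨ ∑-cong parentFns (λ p → cong (λ b → [ b ] * weight p) (sym (isForestOn-everything p))) ⟩
    forestSum everything                                ∎
    where open ≡-Reasoning

-- The identity holds for n = 0 as well.
theorem4p10 : (n : ℕ) → 1 ≤ n → sumℚ (map weight (forests n)) ≡ rhs n
theorem4p10 n _ = begin
  sumℚ (map weight (forests n))  ≡⟨ sum-forests≡forestSum ⟩
  forestSum everything           ≡⟨ forestSum≡rhs everything ⟩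
  rhs (card everything)          ≡⟨ cong rhs card-everything ⟩
  rhs n                          ∎
  where
  open Grafting n using (card)
  open ForestSums n
  open ≡-Reasoning
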